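{- Let $G$ and $H$ be nontrivial connected finite simple graphs with $\delta(H)>|V(H)|/2$, and let $S\subseteq E(G\times H)$. If $|S|<\delta(G)\delta(H)$, then each $H$-fiber ${_xH}=\{(x,u):u\in V(H)\}$ ($x\in V(G)$) is contained in a single connected component of $G\times H-S$. Moreover, unless $G=K_2$ and $H\cong\overline{K_{2l-1}}\vee lK_2$ for some positive integer $l$, the same conclusion holds whenever $|S|=\delta(G)\delta(H)$ and $S$ is not, for any vertex $w$ of $G\times H$, equal to the set of all edges of $G\times H$ incident with $w$.
   Context: All graphs are finite, undirected, without loops or multiple edges; $\delta(X)$ is the minimum degree. The direct product $G\times H$ has vertex set $V(G)\times V(H)$, with $(x,u)$ adjacent to $(y,v)$ if and only if $xy\in E(G)$ and $uv\in E(H)$. $\overline{K_{2l-1}}\vee lK_2$ denotes the join of an edgeless graph on $2l-1$ vertices with $l$ disjoint copies of $K_2$. -}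

module Defs where

open import Data.Nat using (ℕ; zero; suc; _+_; _*_; _∸_; _⊓_; _/_)
open import Data.Fin using (Fin; zero; suc; toℕ; splitAt)
open import Data.Bool using (Bool; true; false; _∧_; _∨_; not; if_then_else_)
open import Data.Product using (Σ; ∃; _×_; _,_; proj₁; proj₂)
open import Data.Sum using (_⊎_; inj₁; inj₂)
open import Relation.Binary.PropositionalEquality using (_≡_; _≢_)
open import Relation.Nullary.Decidable using (⌊_⌋)
open import Function.Bundles using (_↔_; Inverse)
import Data.Fin.Properties as FinP
import Data.Nat.Properties as NatP

record Graph : Set where
  field
    V     : ℕ
    Adj   : Fin V → Fin V → Bool
    sym   : ∀ x y → Adj x y ≡ Adj y x
    loopless : ∀ x → Adj x x ≡ false
open Graph public

count : ∀ {n} → (Fin n → Bool) → ℕ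
count {zero}  p = 0
count {suc n} p = (if p zero then 1 else 0) + count {n} (λ i → p (suc i))

-- minimum of a function over Fin n (0 for the empty set, unused here)
minOver : ∀ n → (Fin n → ℕ) → ℕ
minOver zero f = 0
minOver (suc zero) f = f zero
minOver (suc (suc n)) f = f zero ⊓ minOver (suc n) (λ i → f (suc i))

degree : (G : Graph) → Fin (V G) → ℕ
degree G x = count (λ y → Adj G x y)

δ : Graph → ℕ
δ G = minOver (V G) (degree G)

data Reach {A : Set} (E : A → A → Bool) : A → A → Set where
  here : ∀ {a} → Reach E a a
  step : ∀ {a b c} → E a b ≡ true → Reach E b c → Reach E a c

Connected : Graph → Set
Connected G = ∀ x y → Reach (Adj G) x y

PV : Graph → Graph → Set
PV G H = Fin (V G) × Fin (V H)

prodAdj : (G H : Graph) → PV G H → PV G H → Bool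
prodAdj G H (x , u) (y , v) = Adj G x y ∧ Adj H u v

record EdgeSet (G H : Graph) : Set where
  field
    mem    : PV G H → PV G H → Bool
    memSym : ∀ a b → mem a b ≡ mem b a
    memSub : ∀ a b → mem a b ≡ true → prodAdj G H a b ≡ true
open EdgeSet public

sumFin : ∀ {n} → (Fin n → ℕ) → ℕ
sumFin {zero}  f = 0
sumFin {suc n} f = f zero + sumFin {n} (λ i → f (suc i))

orderedCount : {G H : Graph} → EdgeSet G H → ℕ
orderedCount {G} {H} S =
  sumFin {V G} (λ x → sumFin {V H} (λ u →
    sumFin {V G} (λ y → count {V H} (λ v → mem S (x , u) (y , v)))))

-- |S| : S is symmetric and loopless, so every edge is counted exactly
-- twice as an ordered pair; the number of edges is half the count
card : {G H : Graph} → EdgeSet G H → ℕ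
card S = orderedCount S / 2

removeAdj : (G H : Graph) → EdgeSet G H → PV G H → PV G H → Bool
removeAdj G H S a b = prodAdj G H a b ∧ not (mem S a b)

FibersConnected : (G H : Graph) → EdgeSet G H → Set
FibersConnected G H S =
  ∀ (x : Fin (V G)) (u v : Fin (V H)) → Reach (removeAdj G H S) (x , u) (x , v)

IsStarAt : (G H : Graph) → EdgeSet G H → PV G H → Set
IsStarAt G H S w =
  ∀ a b → (mem S a b ≡ true) ⇔' (prodAdj G H a b ≡ true × (a ≡ w ⊎ b ≡ w))
  where
    _⇔'_ : Set → Set → Set
    P ⇔' Q = (P → Q) × (Q → P)

IsK2 : Graph → Set
IsK2 G = Σ (V G ≡ 2) (λ _ → ∀ (x y : Fin (V G)) → x ≢ y → Adj G x y ≡ true)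

-- The graph K̄_{2l-1} ∨ lK₂ on Fin ((2l-1) + 2l): the first 2l-1 vertices
-- are pairwise non-adjacent and adjacent to each of the last 2l vertices;
-- the last 2l vertices r₀,…,r_{2l-1} induce the l disjoint edges
-- {r_{2i}, r_{2i+1}} (i < l).
joinV : ℕ → ℕ
joinV l = (2 * l ∸ 1) + 2 * l

joinAdj : (l : ℕ) → Fin (joinV l) → Fin (joinV l) → Bool
joinAdj l i j = go (splitAt (2 * l ∸ 1) i) (splitAt (2 * l ∸ 1) j)
  where
    go : Fin (2 * l ∸ 1) ⊎ Fin (2 * l) → Fin (2 * l ∸ 1) ⊎ Fin (2 * l) → Bool
    go (inj₁ _) (inj₁ _) = false
    go (inj₁ _) (inj₂ _) = true
    go (inj₂ _) (inj₁ _) = true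
    go (inj₂ r) (inj₂ s) =
      not ⌊ r FinP.≟ s ⌋ ∧ ⌊ toℕ r / 2 NatP.≟ toℕ s / 2 ⌋

IsoToJoin : Graph → ℕ → Set
IsoToJoin H l =
  Σ (Fin (V H) ↔ Fin (joinV l)) (λ f →
    ∀ x y → Adj H x y ≡ joinAdj l (Inverse.to f x) (Inverse.to f y))

module Submission where

-- Fix a fibre {x} × V(H), two of its vertices (x,u), (x,v), and
-- let C be the vertex set of the component of (x,u) in G × H − S (computed as a
-- Boolean predicate by iterating the closure under one step).  If (x,v) ∉ C,
-- every edge of G × H with exactly one end in C lies in S.  For adjacent fibres
-- z, y of G these edges form a "bipartite cut" of H between the traces
-- C_z, C_y ⊆ V(H), and the central counting lemma (cut-lower-bound) says that
-- such a cut has at least δ(H) edges as soon as C_z is non-constant, because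
-- |V(H)| < 2δ(H).  Summing over the neighbours of x (each crossing edge is seen
-- at most twice in the ordered count of S) gives |S| ≥ deg(x)·δ(H) ≥ δ(G)δ(H),
-- which proves the first claim.  In the equality case all these bounds are
-- tight: every cut at x has exactly δ(H) edges, and S contains nothing else.
-- Either some neighbour y of x has a non-constant trace, and then tightness
-- forces G = K₂ and H to carry a "join structure", which is shown to be
-- isomorphic to K̄_{2l-1} ∨ lK₂; or all neighbouring traces are constant, and
-- then C_x is a single vertex w and S is exactly the star at w.

open import Defs hiding (sym)
open import Data.Nat using (ℕ; zero; suc; _+_; _*_; _∸_; _≤_; _<_; z≤n; s≤s; _/_; _%_)
import Data.Nat.Properties as NP
open import Data.Nat.DivMod using (m≡m%n+[m/n]*n; m%n<n; m*n/n≡m; /-monoˡ-≤; m/n*n≤m)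
open import Data.Nat.Tactic.RingSolver using (solve-∀)
open import Data.Fin using (Fin; zero; suc; toℕ; splitAt; _↑ˡ_; _↑ʳ_; cast; fromℕ<; punchOut)
import Data.Fin.Properties as FP
open import Data.Fin.Permutation using (permutation)
open import Data.Bool using (Bool; true; false; _∧_; _∨_; not; if_then_else_; _xor_)
open import Data.Bool.Properties using (∧-zeroʳ; ∧-identityʳ; ∧-comm; not-involutive; xor-annihilates-not)
open import Data.Maybe using (Maybe; just; nothing; fromMaybe)
import Data.Maybe as Maybe
open import Data.Product using (Σ; _×_; _,_; proj₁; proj₂)
open import Data.Sum using (_⊎_; inj₁; inj₂; [_,_]′)
open import Data.Empty using (⊥; ⊥-elim)
open import Relation.Nullary using (¬_; Dec; yes; no)
open import Relation.Nullary.Decidable using (⌊_⌋)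
open import Relation.Binary.PropositionalEquality using (_≡_; _≢_; refl; sym; trans; cong; cong₂; subst; subst₂; module ≡-Reasoning)
open import Function using (_∘_)
open import Function.Bundles using (mk↔ₛ′)
open import Algebra.Properties.CommutativeMonoid.Sum NP.+-0-commutativeMonoid as MonoidSum using (sum-permute)

true-or-false : (b : Bool) → b ≡ true ⊎ b ≡ false
true-or-false true  = inj₁ refl
true-or-false false = inj₂ refl

∧-true : ∀ {u v} → (u ∧ v) ≡ true → u ≡ true × v ≡ true
∧-true {true} {true} _ = refl , refl

∧-false : ∀ {u v} → (u ∧ v) ≡ false → u ≡ false ⊎ v ≡ false
∧-false {false} _ = inj₁ refl
∧-false {true}  e = inj₂ e

false≢true : false ≢ true
false≢true ()

∧-false≢true : ∀ u → (u ∧ false) ≡ true → ⊥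
∧-false≢true u e with trans (sym (∧-zeroʳ u)) e
... | ()

not-true : ∀ {u} → not u ≡ true → u ≡ false
not-true {false} _ = refl

not-false : ∀ {u} → not u ≡ false → u ≡ true
not-false {true} _ = refl

∨-trueʳ : ∀ u {v} → v ≡ true → (u ∨ v) ≡ true
∨-trueʳ true  _ = refl
∨-trueʳ false e = e

bool-ext : ∀ {a b : Bool} → (a ≡ true → b ≡ true) → (b ≡ true → a ≡ true) → a ≡ b
bool-ext {false} {false} f g = refl
bool-ext {false} {true}  f g = g refl
bool-ext {true}  {false} f g = sym (f refl)
bool-ext {true}  {true}  f g = refl

-- Boolean equality test on Fin n, so that singletons are Boolean predicates.
_==_ : ∀ {n} → Fin n → Fin n → Bool
zero  == zero  = true
zero  == suc _ = false
suc _ == zero  = false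
suc a == suc b = a == b

==-refl : ∀ {n} (a : Fin n) → (a == a) ≡ true
==-refl zero    = refl
==-refl (suc a) = ==-refl a

==→≡ : ∀ {n} (a b : Fin n) → (a == b) ≡ true → a ≡ b
==→≡ zero    zero    e = refl
==→≡ (suc a) (suc b) e = cong suc (==→≡ a b e)

≢→==f : ∀ {n} (a b : Fin n) → a ≢ b → (a == b) ≡ false
≢→==f a b ne with true-or-false (a == b)
... | inj₁ e = ⊥-elim (ne (==→≡ a b e))
... | inj₂ e = e

==f→≢ : ∀ {n} (a b : Fin n) → (a == b) ≡ false → a ≢ b
==f→≢ a .a e refl with trans (sym e) (==-refl a)
... | ()

sum-ext : ∀ {n} {f g : Fin n → ℕ} → (∀ i → f i ≡ g i) → sumFin f ≡ sumFin g
sum-ext {zero}  e = refl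
sum-ext {suc n} e = cong₂ _+_ (e zero) (sum-ext (λ i → e (suc i)))

sum-mono : ∀ {n} {f g : Fin n → ℕ} → (∀ i → f i ≤ g i) → sumFin f ≤ sumFin g
sum-mono {zero}  e = z≤n
sum-mono {suc n} e = NP.+-mono-≤ (e zero) (sum-mono (λ i → e (suc i)))

sum-+ : ∀ {n} (f g : Fin n → ℕ) → sumFin (λ i → f i + g i) ≡ sumFin f + sumFin g
sum-+ {zero}  f g = refl
sum-+ {suc n} f g = trans (cong (f zero + g zero +_) (sum-+ (f ∘ suc) (g ∘ suc)))
                          (interchange (f zero) (g zero) _ _)
  where
  interchange : ∀ a b c d → (a + b) + (c + d) ≡ (a + c) + (b + d)
  interchange = solve-∀

sum-const : ∀ {n} (c : ℕ) → sumFin {n} (λ _ → c) ≡ n * c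
sum-const {zero}  c = refl
sum-const {suc n} c = cong (c +_) (sum-const {n} c)

sum-ub : ∀ {n} {f : Fin n → ℕ} (c : ℕ) → (∀ i → f i ≤ c) → sumFin f ≤ n * c
sum-ub {n} c h = subst (_ ≤_) (sum-const {n} c) (sum-mono h)

sum-point : ∀ {n} (f : Fin n → ℕ) (j : Fin n) → f j ≤ sumFin f
sum-point f zero    = NP.m≤m+n _ _
sum-point f (suc j) = NP.≤-trans (sum-point (f ∘ suc) j) (NP.m≤n+m _ (f zero))

sum-zero-pt : ∀ {n} (f : Fin n → ℕ) → sumFin f ≡ 0 → ∀ i → f i ≡ 0
sum-zero-pt f e i = NP.n≤0⇒n≡0 (subst (f i ≤_) e (sum-point f i))

sum-pick : ∀ {n} (g h : Fin n → ℕ) (x : Fin n) → h x ≡ 0 →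
           (∀ z → z ≢ x → h z ≤ g z) → g x + sumFin h ≤ sumFin g
sum-pick {suc n} g h zero hx le rewrite hx =
  NP.+-monoʳ-≤ (g zero) (sum-mono (λ i → le (suc i) (λ ())))
sum-pick {suc n} g h (suc x) hx le =
  subst (_≤ sumFin g) (sym (swap-front (g (suc x)) (h zero) (sumFin (h ∘ suc))))
    (NP.+-mono-≤ (le zero (λ ()))
      (sum-pick (g ∘ suc) (h ∘ suc) x hx (λ z ne → le (suc z) (λ e → ne (FP.suc-injective e)))))
  where
  swap-front : ∀ a b c → a + (b + c) ≡ b + (a + c)
  swap-front = solve-∀

sum-single : ∀ {n} (k : Fin n) (c : ℕ) → sumFin (λ z → if z == k then c else 0) ≡ c
sum-single {suc n} zero c =
  trans (cong (c +_) (trans (sum-const {n} 0) (NP.*-zeroʳ n))) (NP.+-identityʳ c)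
sum-single {suc n} (suc k) c = sum-single k c

sum-two : ∀ {n} (f : Fin n → ℕ) (j k : Fin n) → j ≢ k → f j + f k ≤ sumFin f
sum-two f j k ne = subst (λ t → f j + t ≤ sumFin f) (sum-single k (f k))
  (sum-pick f (λ z → if z == k then f k else 0) j (off-k (≢→==f j k ne)) (λ z _ → below z))
  where
  off-k : ∀ {b} → b ≡ false → (if b then f k else 0) ≡ 0
  off-k refl = refl
  below : ∀ z → (if z == k then f k else 0) ≤ f z
  below z with z == k in eq
  ... | true rewrite ==→≡ z k eq = NP.≤-refl
  ... | false = z≤n

sum-swap : ∀ {m n} (f : Fin m → Fin n → ℕ) →
  sumFin {m} (λ i → sumFin {n} (f i)) ≡ sumFin {n} (λ j → sumFin {m} (λ i → f i j))
sum-swap {zero}  {n} f = sym (trans (sum-const {n} 0) (NP.*-zeroʳ n))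
sum-swap {suc m} {n} f = trans (cong (sumFin (f zero) +_) (sum-swap (f ∘ suc)))
  (sym (sum-+ (f zero) (λ j → sumFin (λ i → f (suc i) j))))

sum-strict : ∀ {n} {f g : Fin n → ℕ} (j : Fin n) → (∀ i → f i ≤ g i) → f j < g j →
             sumFin f < sumFin g
sum-strict zero    le lt = NP.+-mono-<-≤ lt (sum-mono (λ i → le (suc i)))
sum-strict (suc j) le lt = NP.+-mono-≤-< (le zero) (sum-strict j (λ i → le (suc i)) lt)

sum-eq-pt : ∀ {n} {f g : Fin n → ℕ} → (∀ i → f i ≤ g i) → sumFin g ≤ sumFin f →
            ∀ i → f i ≡ g i
sum-eq-pt le ge i with NP.m≤n⇒m<n∨m≡n (le i)
... | inj₂ e  = e
... | inj₁ lt = ⊥-elim (NP.<-irrefl refl (NP.<-≤-trans (sum-strict i le lt) ge))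

ind : Bool → ℕ
ind b = if b then 1 else 0

count-sum : ∀ {n} (p : Fin n → Bool) → count p ≡ sumFin (λ i → ind (p i))
count-sum {zero}  p = refl
count-sum {suc n} p = cong (ind (p zero) +_) (count-sum (p ∘ suc))

sum-ind-mul : ∀ {n} (p : Fin n → Bool) (c : ℕ) → sumFin (λ i → if p i then c else 0) ≡ count p * c
sum-ind-mul {zero}  p c = refl
sum-ind-mul {suc n} p c with p zero
... | true  = cong (c +_) (sum-ind-mul (p ∘ suc) c)
... | false = sum-ind-mul (p ∘ suc) c

count-ext : ∀ {n} {p q : Fin n → Bool} → (∀ i → p i ≡ q i) → count p ≡ count q
count-ext {zero}  e = refl
count-ext {suc n} e = cong₂ _+_ (cong ind (e zero)) (count-ext (λ i → e (suc i)))

ind-mono : ∀ {a b} → (a ≡ true → b ≡ true) → ind a ≤ ind b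
ind-mono {false} h = z≤n
ind-mono {true}  h rewrite h refl = NP.≤-refl

count-mono : ∀ {n} {p q : Fin n → Bool} → (∀ i → p i ≡ true → q i ≡ true) → count p ≤ count q
count-mono {zero}  h = z≤n
count-mono {suc n} h = NP.+-mono-≤ (ind-mono (h zero)) (count-mono (λ i → h (suc i)))

count-le : ∀ {n} (p : Fin n → Bool) → count p ≤ n
count-le {zero}  p = z≤n
count-le {suc n} p with p zero
... | true  = s≤s (count-le (p ∘ suc))
... | false = NP.m≤n⇒m≤1+n (count-le (p ∘ suc))

count-compl : ∀ {n} (p : Fin n → Bool) → count p + count (λ i → not (p i)) ≡ n
count-compl {zero}  p = refl
count-compl {suc n} p with p zero
... | true  = cong suc (count-compl (p ∘ suc))
... | false = trans (NP.+-suc (count (p ∘ suc)) _) (cong suc (count-compl (p ∘ suc)))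

count-false : ∀ {n} → count {n} (λ _ → false) ≡ 0
count-false {zero}  = refl
count-false {suc n} = count-false {n}

count-true : ∀ {n} → count {n} (λ _ → true) ≡ n
count-true {zero}  = refl
count-true {suc n} = cong suc (count-true {n})

count-pos : ∀ {n} (p : Fin n → Bool) (i : Fin n) → p i ≡ true → 1 ≤ count p
count-pos p zero    e rewrite e = s≤s z≤n
count-pos p (suc i) e = NP.≤-trans (count-pos (p ∘ suc) i e) (NP.m≤n+m _ _)

count-zero : ∀ {n} (p : Fin n → Bool) → count p ≡ 0 → ∀ i → p i ≡ false
count-zero p e i with p i in eq
... | false = refl
... | true  = ⊥-elim (NP.<-irrefl refl (subst (0 <_) e (count-pos p i eq)))

count-witness : ∀ {n} (p : Fin n → Bool) → 1 ≤ count p → Σ (Fin n) (λ w → p w ≡ true)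
count-witness {suc n} p h with p zero in eq
... | true  = zero , eq
... | false with count-witness (p ∘ suc) h
...   | w , e = suc w , e

count-two : ∀ {n} (p : Fin n → Bool) (i j : Fin n) → i ≢ j → p i ≡ true → p j ≡ true →
            2 ≤ count p
count-two p i j ne pi pj = from-sum (sum-two (λ k → ind (p k)) i j ne)
  where
  from-sum : ind (p i) + ind (p j) ≤ sumFin (λ k → ind (p k)) → 2 ≤ count p
  from-sum h rewrite pi | pj | count-sum p = h

count-strict : ∀ {n} {p q : Fin n → Bool} (j : Fin n) → (∀ i → p i ≡ true → q i ≡ true) →
  q j ≡ true → p j ≡ false → count p < count q
count-strict {p = p} {q} j h qj pj rewrite count-sum p | count-sum q =
  sum-strict j (λ i → ind-mono (h i)) (ind-lt qj pj)
  where
  ind-lt : ∀ {a b} → b ≡ true → a ≡ false → ind a < ind b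
  ind-lt refl refl = s≤s z≤n

count-eqsub : ∀ {n} {p q : Fin n → Bool} → (∀ i → p i ≡ true → q i ≡ true) →
  count q ≤ count p → ∀ i → q i ≡ true → p i ≡ true
count-eqsub {p = p} h le i qi with p i in eq
... | true  = refl
... | false = ⊥-elim (NP.<-irrefl refl (NP.<-≤-trans (count-strict i h qi eq) le))

count-split : ∀ {n} (p q : Fin n → Bool) →
  count p ≡ count (λ i → p i ∧ q i) + count (λ i → p i ∧ not (q i))
count-split {zero} p q = refl
count-split {suc n} p q with p zero | q zero
... | true  | true  = cong suc (count-split (p ∘ suc) (q ∘ suc))
... | true  | false = trans (cong suc (count-split (p ∘ suc) (q ∘ suc))) (sym (NP.+-suc _ _))
... | false | true  = count-split (p ∘ suc) (q ∘ suc)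
... | false | false = count-split (p ∘ suc) (q ∘ suc)

count-eq1 : ∀ {n} (a : Fin n) → count (λ i → i == a) ≡ 1
count-eq1 {suc n} zero    = cong suc (count-false {n})
count-eq1 {suc n} (suc a) = count-eq1 a

count≤1 : ∀ {n} (p : Fin n → Bool) (a : Fin n) → (∀ i → p i ≡ true → i ≡ a) → count p ≤ 1
count≤1 p a h = subst (count p ≤_) (count-eq1 a)
  (count-mono (λ i e → subst (λ z → (i == z) ≡ true) (h i e) (==-refl i)))

count-or2 : ∀ {n} (a b : Fin n) → a ≢ b → count (λ i → (i == a) ∨ (i == b)) ≡ 2
count-or2 a b ne = trans (count-split (λ i → (i == a) ∨ (i == b)) (λ i → i == a))
  (cong₂ _+_ (trans (count-ext is-a) (count-eq1 a)) (trans (count-ext is-b) (count-eq1 b)))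
  where
  is-a : ∀ i → (((i == a) ∨ (i == b)) ∧ (i == a)) ≡ (i == a)
  is-a i with i == a
  ... | true  = refl
  ... | false = ∧-zeroʳ (i == b)
  is-b : ∀ i → (((i == a) ∨ (i == b)) ∧ not (i == a)) ≡ (i == b)
  is-b i with i == a in ea
  ... | false = ∧-identityʳ (i == b)
  ... | true with i == b in eb
  ...   | false = refl
  ...   | true  = ⊥-elim (ne (trans (sym (==→≡ i a ea)) (==→≡ i b eb)))

count-swap : ∀ {m n} (f : Fin m → Fin n → Bool) →
  sumFin {m} (λ i → count {n} (f i)) ≡ sumFin {n} (λ j → count {m} (λ i → f i j))
count-swap f = trans (sum-ext (λ i → count-sum (f i)))
  (trans (sum-swap (λ i j → ind (f i j))) (sym (sum-ext (λ j → count-sum (λ i → f i j)))))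

count-involution : ∀ {k} (P : Fin k → Bool) (σ : Fin k → Fin k) → (∀ i → σ (σ i) ≡ i) →
                   count (λ i → P (σ i)) ≡ count P
count-involution P σ inv = trans (count-sum (P ∘ σ))
  (trans (sym (monoid-sum (λ i → ind (P (σ i)))))
    (trans (sym (sum-permute (λ i → ind (P i)) (permutation σ σ inv inv)))
      (trans (monoid-sum (λ i → ind (P i))) (sym (count-sum P)))))
  where
  monoid-sum : ∀ {k} (f : Fin k → ℕ) → MonoidSum.sum f ≡ sumFin f
  monoid-sum {zero}  f = refl
  monoid-sum {suc k} f = cong (f zero +_) (monoid-sum (f ∘ suc))

-- Degrees: δ is a lower bound for every degree, and degrees are < |V|
-- because graphs are loopless.

minOver-le : ∀ n (f : Fin n → ℕ) (i : Fin n) → minOver n f ≤ f i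
minOver-le (suc zero)    f zero    = NP.≤-refl
minOver-le (suc (suc n)) f zero    = NP.m⊓n≤m _ _
minOver-le (suc (suc n)) f (suc i) = NP.≤-trans (NP.m⊓n≤n _ _) (minOver-le (suc n) (f ∘ suc) i)

δ-le : ∀ (G : Graph) (x : Fin (V G)) → δ G ≤ degree G x
δ-le G x = minOver-le (V G) (degree G) x

count<n : ∀ {n} (p : Fin n → Bool) (a : Fin n) → p a ≡ false → count p < n
count<n p a e = subst (count p <_) (count-compl p)
  (subst (_≤ count p + count (λ i → not (p i))) (NP.+-comm (count p) 1)
    (NP.+-monoʳ-≤ (count p) (count-pos (λ i → not (p i)) a (cong not e))))

δ<n : ∀ (G : Graph) (x : Fin (V G)) → δ G < V G
δ<n G x = NP.≤-<-trans (δ-le G x) (count<n (Adj G x) x (loopless G x))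

factorˡ-≤ : ∀ {e} a b → 1 ≤ b → a * b ≤ e → a ≤ e
factorˡ-≤ a (suc b) _ le = NP.≤-trans (subst (a ≤_) (sym (NP.*-suc a b)) (NP.m≤m+n a (a * b))) le

factorʳ-≤ : ∀ {e} a b → 1 ≤ a → a * b ≤ e → b ≤ e
factorʳ-≤ {e} a b h le = factorˡ-≤ b a h (subst (_≤ e) (NP.*-comm a b) le)

factor≤1 : ∀ a d → 1 ≤ d → a * d ≤ d → a ≤ 1
factor≤1 zero          d _ _ = z≤n
factor≤1 (suc zero)    d _ _ = s≤s z≤n
factor≤1 (suc (suc a)) d h le = ⊥-elim (NP.<-irrefl refl (NP.<-≤-trans d<2d le))
  where
  d<2d : d < d + (d + a * d)
  d<2d = NP.≤-trans (subst (_≤ d + d) (NP.+-comm d 1) (NP.+-monoʳ-≤ d h))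
                    (NP.+-monoʳ-≤ d (NP.m≤m+n d (a * d)))

zero-or-pos : ∀ q → q ≡ 0 ⊎ 1 ≤ q
zero-or-pos zero    = inj₁ refl
zero-or-pos (suc q) = inj₂ (s≤s z≤n)

double-> : ∀ {a} → 1 ≤ a → suc a ≤ a + a
double-> {suc a} _ = s≤s (subst (suc a ≤_) (sym (NP.+-suc a a)) (s≤s (NP.m≤m+n a a)))

-- For P, Q ⊆ V(H) put p = |P|,
-- p' = |V∖P|, q = |Q|, q' = |V∖Q|; the cut consists of e₁ edges from P to
-- V∖Q and e₂ edges from V∖P to Q.  A vertex of P has ≥ d neighbours, of which
-- at most q lie in Q, which gives bound₁; the other bounds are symmetric.
-- With |V(H)| = n < 2d these four inequalities are all the lemma needs.
record CutCounts : Set where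
  field
    p p' q q' n d e₁ e₂ : ℕ
    p+p'≡n : p + p' ≡ n
    q+q'≡n : q + q' ≡ n
    1≤p    : 1 ≤ p
    1≤p'   : 1 ≤ p'
    n<2d   : n < d + d
    d<n    : d < n
    bound₁ : p * (d ∸ q) ≤ e₁
    bound₂ : p' * (d ∸ q') ≤ e₂
    bound₃ : q * (d ∸ p) ≤ e₂
    bound₄ : q' * (d ∸ p') ≤ e₁

complementCounts : CutCounts → CutCounts
complementCounts c = record
  { p = p' ; p' = p ; q = q' ; q' = q ; n = n ; d = d ; e₁ = e₂ ; e₂ = e₁
  ; p+p'≡n = trans (NP.+-comm p' p) p+p'≡n ; q+q'≡n = trans (NP.+-comm q' q) q+q'≡n
  ; 1≤p = 1≤p' ; 1≤p' = 1≤p ; n<2d = n<2d ; d<n = d<n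
  ; bound₁ = bound₂ ; bound₂ = bound₁ ; bound₃ = bound₄ ; bound₄ = bound₃ }
  where open CutCounts c

-- Shapes of a cut with e₁ + e₂ ≤ d and Q non-constant: P and V∖Q are both
-- large (≥ d), or P and V∖Q are both small, or d = 2 (then H = K₃).
data TightShape (c : CutCounts) : Set where
  large-P  : let open CutCounts c in d ≤ p  → d ≤ q' → TightShape c
  small-P  : let open CutCounts c in d ≤ p' → d ≤ q  → TightShape c
  triangle : CutCounts.d c ≡ 2 → TightShape c

module CutArithmetic (c : CutCounts) where
  open CutCounts c

  pos∸ : ∀ {a b} → a < b → 1 ≤ b ∸ a
  pos∸ = NP.m<n⇒0<n∸m

  -- if q < d, the cut has at least d edges: e₁ ≥ p(d − q) ≥ p ≥ d when d ≤ p,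
  -- e₁ ≥ d when q = 0, and otherwise e₁ ≥ d − q and e₂ ≥ q(d − p) ≥ q
  cut≥d : q < d → d ≤ e₁ + e₂
  cut≥d q<d with d NP.≤? p
  ... | yes d≤p = NP.≤-trans d≤p (NP.≤-trans (factorˡ-≤ p (d ∸ q) (pos∸ q<d) bound₁) (NP.m≤m+n e₁ e₂))
  ... | no d≰p with zero-or-pos q
  ...   | inj₁ refl = NP.≤-trans (factorʳ-≤ p d 1≤p bound₁) (NP.m≤m+n e₁ e₂)
  ...   | inj₂ 1≤q  = subst (_≤ e₁ + e₂) (NP.m∸n+n≡m (NP.<⇒≤ q<d))
          (NP.+-mono-≤ (factorʳ-≤ p (d ∸ q) 1≤p bound₁)
                       (factorˡ-≤ q (d ∸ p) (pos∸ (NP.≰⇒> d≰p)) bound₃))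

  cut≥n-by-q : q < d → q' < d → n ≤ e₁ + e₂
  cut≥n-by-q q<d q'<d = subst (_≤ e₁ + e₂) p+p'≡n
    (NP.+-mono-≤ (factorˡ-≤ p (d ∸ q) (pos∸ q<d) bound₁) (factorˡ-≤ p' (d ∸ q') (pos∸ q'<d) bound₂))

  cut≥n-by-p : p < d → p' < d → n ≤ e₁ + e₂
  cut≥n-by-p p<d p'<d = subst (_≤ e₁ + e₂) (trans (NP.+-comm q' q) q+q'≡n)
    (NP.+-mono-≤ (factorˡ-≤ q' (d ∸ p') (pos∸ p'<d) bound₄) (factorˡ-≤ q (d ∸ p) (pos∸ p<d) bound₃))

  2≤d : 2 ≤ d
  2≤d = NP.≰⇒> (λ d≤1 → NP.<-irrefl refl (NP.<-≤-trans n<2d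
          (NP.≤-trans (NP.+-mono-≤ d≤1 d≤1) (subst (2 ≤_) p+p'≡n (NP.+-mono-≤ 1≤p 1≤p')))))

  -- If 2 ≤ p < d and q < d, then e₁ ≥ 2(d − q) > d − q and e₂ ≥ q: the cut exceeds d.
  cut>d-if-p≥2 : q < d → p < d → 2 ≤ p → d < e₁ + e₂
  cut>d-if-p≥2 q<d p<d 2≤p = subst (_< e₁ + e₂) (NP.m∸n+n≡m (NP.<⇒≤ q<d))
      (NP.+-mono-≤ e₁-bound (factorˡ-≤ q (d ∸ p) (pos∸ p<d) bound₃))
    where
    e₁-bound : suc (d ∸ q) ≤ e₁
    e₁-bound = NP.≤-trans (double-> (pos∸ q<d))
      (NP.≤-trans (subst (_≤ p * (d ∸ q)) (cong ((d ∸ q) +_) (NP.+-identityʳ (d ∸ q)))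
                         (NP.*-monoˡ-≤ (d ∸ q) 2≤p)) bound₁)

  -- If p = 1, 1 ≤ q < d and d ≥ 3, then e₁ ≥ d − q and e₂ ≥ 2q > q: the cut exceeds d.
  cut>d-if-p≡1 : q < d → 1 ≤ q → p ≡ 1 → 3 ≤ d → d < e₁ + e₂
  cut>d-if-p≡1 q<d 1≤q p≡1 3≤d = subst (_< e₁ + e₂) (NP.m∸n+n≡m (NP.<⇒≤ q<d))
      (subst (_≤ e₁ + e₂) (NP.+-suc (d ∸ q) q) (NP.+-mono-≤ (factorʳ-≤ p (d ∸ q) 1≤p bound₁) e₂-bound))
    where
    2≤d∸p : 2 ≤ d ∸ p
    2≤d∸p rewrite p≡1 = NP.≤-trans (s≤s (s≤s z≤n)) (NP.∸-monoˡ-≤ 1 3≤d)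
    e₂-bound : suc q ≤ e₂
    e₂-bound = NP.≤-trans (subst (suc q ≤_) (cong (q +_) (sym (NP.+-identityʳ q))) (double-> 1≤q))
      (NP.≤-trans (subst (_≤ q * (d ∸ p)) (NP.*-comm q 2) (NP.*-monoʳ-≤ q 2≤d∸p)) bound₃)

  tight-shape : 1 ≤ q → 1 ≤ q' → e₁ + e₂ ≤ d → q < d → TightShape c
  tight-shape 1≤q 1≤q' tight q<d with q' NP.<? d
  ... | yes q'<d = ⊥-elim (NP.<-irrefl refl (NP.<-≤-trans d<n (NP.≤-trans (cut≥n-by-q q<d q'<d) tight)))
  ... | no q'≮d with d NP.≤? p
  ...   | yes d≤p = large-P d≤p (NP.≮⇒≥ q'≮d)
  ...   | no d≰p with p' NP.<? d
  ...     | yes p'<d = ⊥-elim (NP.<-irrefl refl (NP.<-≤-trans d<n (NP.≤-trans (cut≥n-by-p (NP.≰⇒> d≰p) p'<d) tight)))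
  ...     | no _ with p NP.≤? 1
  ...       | no p≰1 = ⊥-elim (NP.<-irrefl refl (NP.<-≤-trans (cut>d-if-p≥2 q<d (NP.≰⇒> d≰p) (NP.≰⇒> p≰1)) tight))
  ...       | yes p≤1 with d NP.≤? 2
  ...         | yes d≤2 = triangle (NP.≤-antisym d≤2 2≤d)
  ...         | no d≰2  = ⊥-elim (NP.<-irrefl refl (NP.<-≤-trans
                  (cut>d-if-p≡1 q<d 1≤q (NP.≤-antisym p≤1 1≤p) (NP.≰⇒> d≰2)) tight))

complement<d : ∀ {q q' n d} → q + q' ≡ n → n < d + d → ¬ (q < d) → q' < d
complement<d {q} {q'} {n} {d} q+q' n<2d q≮d with q' NP.<? d
... | yes h = h
... | no h = ⊥-elim (NP.<-irrefl refl (NP.<-≤-trans n<2d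
               (subst (d + d ≤_) q+q' (NP.+-mono-≤ (NP.≮⇒≥ q≮d) (NP.≮⇒≥ h)))))

cut-counts-lb : (c : CutCounts) → let open CutCounts c in d ≤ e₁ + e₂
cut-counts-lb c with CutCounts.q c NP.<? CutCounts.d c
... | yes q<d = CutArithmetic.cut≥d c q<d
... | no q≮d  = subst (CutCounts.d c ≤_) (NP.+-comm (CutCounts.e₂ c) (CutCounts.e₁ c))
    (CutArithmetic.cut≥d (complementCounts c)
      (complement<d (CutCounts.q+q'≡n c) (CutCounts.n<2d c) q≮d))

cut-counts-tight : (c : CutCounts) → let open CutCounts c in
  1 ≤ q → 1 ≤ q' → e₁ + e₂ ≤ d → TightShape c
cut-counts-tight c 1≤q 1≤q' tight with CutCounts.q c NP.<? CutCounts.d c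
... | yes q<d = CutArithmetic.tight-shape c 1≤q 1≤q' tight q<d
... | no q≮d with CutArithmetic.tight-shape (complementCounts c) 1≤q' 1≤q
                   (subst (_≤ CutCounts.d c) (NP.+-comm (CutCounts.e₁ c) (CutCounts.e₂ c)) tight)
                   (complement<d (CutCounts.q+q'≡n c) (CutCounts.n<2d c) q≮d)
...   | large-P a b = small-P a b
...   | small-P a b = large-P a b
...   | triangle e  = triangle e

-- These are exactly the
-- edges of G × H − C between the fibres over an edge xy of G, when P and Q are
-- the traces of a vertex set C on the fibres of x and y.
module BipartiteCut (H : Graph) where
  n : ℕ
  n = V H
  d : ℕ
  d = δ H
  A : Fin n → Fin n → Bool
  A = Adj H

  cutH : (Fin n → Bool) → (Fin n → Bool) → ℕ
  cutH P Q = sumFin (λ w → count (λ w' → A w w' ∧ (P w xor Q w')))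

  cutTF : (Fin n → Bool) → (Fin n → Bool) → ℕ
  cutTF P Q = sumFin (λ w → count (λ w' → A w w' ∧ (P w ∧ not (Q w'))))

  cutFT : (Fin n → Bool) → (Fin n → Bool) → ℕ
  cutFT P Q = sumFin (λ w → count (λ w' → A w w' ∧ (not (P w) ∧ Q w')))

  cut-split : ∀ P Q → cutH P Q ≡ cutTF P Q + cutFT P Q
  cut-split P Q = trans (sum-ext at)
    (sum-+ (λ w → count (λ w' → A w w' ∧ (P w ∧ not (Q w')))) (λ w → count (λ w' → A w w' ∧ (not (P w) ∧ Q w'))))
    where
    none : ∀ w → count (λ w' → A w w' ∧ false) ≡ 0
    none w = trans (count-ext (λ w' → ∧-zeroʳ (A w w'))) (count-false {n})
    at : ∀ w → count (λ w' → A w w' ∧ (P w xor Q w')) ≡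
               count (λ w' → A w w' ∧ (P w ∧ not (Q w'))) + count (λ w' → A w w' ∧ (not (P w) ∧ Q w'))
    at w with P w
    ... | true  = sym (trans (cong (count (λ w' → A w w' ∧ not (Q w')) +_) (none w)) (NP.+-identityʳ _))
    ... | false = sym (cong (_+ count (λ w' → A w w' ∧ Q w')) (none w))

  -- by symmetry of adjacency, V∖P → Q pairs are Q → V∖P pairs read backwards
  cutFT-transpose : ∀ P Q → cutFT P Q ≡ cutTF Q P
  cutFT-transpose P Q = trans (count-swap (λ w w' → A w w' ∧ (not (P w) ∧ Q w')))
      (sum-ext (λ w' → count-ext (λ w → reverse w w')))
    where
    reverse : ∀ w w' → (A w w' ∧ (not (P w) ∧ Q w')) ≡ (A w' w ∧ (Q w' ∧ not (P w)))
    reverse w w' rewrite Graph.sym H w w' = cong (A w' w ∧_) (∧-comm (not (P w)) (Q w'))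

  cut-sym : ∀ P Q → cutH P Q ≡ cutH Q P
  cut-sym P Q = begin
    cutH P Q                   ≡⟨ cut-split P Q ⟩
    cutTF P Q + cutFT P Q      ≡⟨ cong₂ _+_ (sym (cutFT-transpose Q P)) (cutFT-transpose P Q) ⟩
    cutFT Q P + cutTF Q P      ≡⟨ NP.+-comm (cutFT Q P) (cutTF Q P) ⟩
    cutTF Q P + cutFT Q P      ≡⟨ sym (cut-split Q P) ⟩
    cutH Q P                   ∎
    where open ≡-Reasoning

  cut-compl : ∀ P Q → cutH (λ w → not (P w)) (λ w → not (Q w)) ≡ cutH P Q
  cut-compl P Q = sum-ext (λ w → count-ext (λ w' →
    cong (A w w' ∧_) (xor-annihilates-not (P w) (Q w'))))

  neighbours-in : ∀ w (R : Fin n → Bool) → d ∸ count (λ w' → not (R w')) ≤ count (λ w' → A w w' ∧ R w')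
  neighbours-in w R = NP.m≤n+o⇒m∸n≤o d (count (λ w' → not (R w')))
      (NP.≤-trans (δ-le H w) (subst (degree H w ≤_) (NP.+-comm _ (count (λ w' → not (R w')))) degree-split))
    where
    degree-split : degree H w ≤ count (λ w' → A w w' ∧ R w') + count (λ w' → not (R w'))
    degree-split = subst (_≤ count (λ w' → A w w' ∧ R w') + count (λ w' → not (R w')))
      (sym (count-split (A w) R))
      (NP.+-monoʳ-≤ (count (λ w' → A w w' ∧ R w')) (count-mono {p = λ w' → A w w' ∧ not (R w')} (λ w' e → proj₂ (∧-true {A w w'} e))))

  cutTF-lb : ∀ P Q → count P * (d ∸ count Q) ≤ cutTF P Q
  cutTF-lb P Q = subst (_≤ cutTF P Q) (sum-ind-mul P (d ∸ count Q)) (sum-mono at)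
    where
    at : ∀ w → (if P w then d ∸ count Q else 0) ≤ count (λ w' → A w w' ∧ (P w ∧ not (Q w')))
    at w with P w
    ... | false = z≤n
    ... | true  = subst (λ t → d ∸ t ≤ count (λ w' → A w w' ∧ not (Q w')))
                    (count-ext (λ w' → not-involutive (Q w'))) (neighbours-in w (λ w' → not (Q w')))

  cutFT-lb : ∀ P Q → count (λ w → not (P w)) * (d ∸ count (λ w → not (Q w))) ≤ cutFT P Q
  cutFT-lb P Q = subst (_≤ cutFT P Q) (sum-ind-mul (λ w → not (P w)) _) (sum-mono at)
    where
    at : ∀ w → (if not (P w) then d ∸ count (λ w → not (Q w)) else 0) ≤
               count (λ w' → A w w' ∧ (not (P w) ∧ Q w'))
    at w with P w
    ... | true  = z≤n
    ... | false = neighbours-in w Q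

  -- against a constant Q, every vertex on the other side of P contributes its
  -- full degree
  cut-vs-empty : ∀ P Q → (∀ w → Q w ≡ false) → count P * d ≤ cutH P Q
  cut-vs-empty P Q empty = subst (_≤ cutH P Q) (sum-ind-mul P d) (sum-mono at)
    where
    at : ∀ w → (if P w then d else 0) ≤ count (λ w' → A w w' ∧ (P w xor Q w'))
    at w with P w
    ... | false = z≤n
    ... | true  = NP.≤-trans (δ-le H w) (NP.≤-reflexive (count-ext (λ w' →
                    trans (sym (∧-identityʳ (A w w'))) (cong (λ t → A w w' ∧ not t) (sym (empty w'))))))

  cut-vs-full : ∀ P Q → (∀ w → Q w ≡ true) → count (λ w → not (P w)) * d ≤ cutH P Q
  cut-vs-full P Q full = subst (_≤ cutH P Q) (sum-ind-mul (λ w → not (P w)) d) (sum-mono at)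
    where
    at : ∀ w → (if not (P w) then d else 0) ≤ count (λ w' → A w w' ∧ (P w xor Q w'))
    at w with P w
    ... | true  = z≤n
    ... | false = NP.≤-trans (δ-le H w) (NP.≤-reflexive (count-ext (λ w' →
                    trans (sym (∧-identityʳ (A w w'))) (cong (λ t → A w w' ∧ t) (sym (full w'))))))

-- This is the combinatorial
-- content of H ≅ K̄_{2l-1} ∨ lK₂ (with k = 2l), see join-structure-iso below.
record JoinStructure (H : Graph) : Set where
  field
    R       : Fin (V H) → Bool
    k       : ℕ
    |R|≡k   : count R ≡ k
    n+1≡2k  : suc (V H) ≡ k + k
    outside : ∀ b w → R b ≡ false → Adj H b w ≡ R w
    matched : ∀ r → R r ≡ true → count (λ r' → R r' ∧ Adj H r r') ≡ 1

module CutBound (H : Graph) (n<2d : V H < δ H + δ H) where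
  open BipartiteCut H

  1≤d : 1 ≤ d
  1≤d = positive n<2d
    where
    positive : ∀ {m k} → m < k + k → 1 ≤ k
    positive {k = suc k} _ = s≤s z≤n

  -- a vertex w has degree ≥ d, so 1 + d ≤ n < 2d, whence d ≥ 2
  2≤d : Fin n → 2 ≤ d
  2≤d w = NP.≰⇒> (λ d≤1 → NP.<-irrefl refl (NP.<-≤-trans n<2d
    (NP.≤-trans (NP.≤-trans (NP.+-monoʳ-≤ d d≤1) (NP.≤-reflexive (NP.+-comm d 1))) (δ<n H w))))

  cut-counts : ∀ P Q (a b : Fin n) → P a ≡ true → P b ≡ false → CutCounts
  cut-counts P Q a b pa pb = record
    { p = count P ; p' = count (λ w → not (P w)) ; q = count Q ; q' = count (λ w → not (Q w))
    ; n = n ; d = d ; e₁ = cutTF P Q ; e₂ = cutFT P Q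
    ; p+p'≡n = count-compl P ; q+q'≡n = count-compl Q
    ; 1≤p = count-pos P a pa ; 1≤p' = count-pos (λ w → not (P w)) b (cong not pb)
    ; n<2d = n<2d ; d<n = δ<n H a
    ; bound₁ = cutTF-lb P Q
    ; bound₂ = cutFT-lb P Q
    ; bound₃ = subst (count Q * (d ∸ count P) ≤_) (sym (cutFT-transpose P Q)) (cutTF-lb Q P)
    ; bound₄ = subst (count (λ w → not (Q w)) * (d ∸ count (λ w → not (P w))) ≤_)
                     (cutFT-transpose Q P) (cutFT-lb Q P) }

  cut-lower-bound : ∀ P Q (a b : Fin n) → P a ≡ true → P b ≡ false → d ≤ cutH P Q
  cut-lower-bound P Q a b pa pb =
    subst (d ≤_) (sym (cut-split P Q)) (cut-counts-lb (cut-counts P Q a b pa pb))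

  module LargeTightCut (P Q : Fin n → Bool) (d≤p : d ≤ count P)
                       (d≤q' : d ≤ count (λ w → not (Q w))) (tight : cutH P Q ≤ d) where
    p = count P
    p' = count (λ w → not (P w))
    q = count Q
    q' = count (λ w → not (Q w))

    q<d : q < d
    q<d = complement<d (trans (NP.+-comm q' q) (count-compl Q)) n<2d (λ q'<d → NP.<⇒≱ q'<d d≤q')

    out : Fin n → ℕ
    out w = count (λ w' → A w w' ∧ not (Q w'))

    out≥d∸q : ∀ w → d ∸ q ≤ out w
    out≥d∸q w = subst (λ t → d ∸ t ≤ out w) (count-ext (λ w' → not-involutive (Q w')))
                      (neighbours-in w (λ w' → not (Q w')))

    out≥1 : ∀ w → 1 ≤ out w
    out≥1 w = NP.≤-trans (NP.m<n⇒0<n∸m q<d) (out≥d∸q w)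

    cutTF≡ : cutTF P Q ≡ sumFin (λ w → if P w then out w else 0)
    cutTF≡ = sum-ext at
      where
      at : ∀ w → count (λ w' → A w w' ∧ (P w ∧ not (Q w'))) ≡ (if P w then out w else 0)
      at w with P w
      ... | true  = refl
      ... | false = trans (count-ext (λ w' → ∧-zeroʳ (A w w'))) (count-false {n})

    ind≤out : ∀ w → ind (P w) ≤ (if P w then out w else 0)
    ind≤out w with P w
    ... | true  = out≥1 w
    ... | false = z≤n

    p≤cutTF : p ≤ cutTF P Q
    p≤cutTF = subst (_≤ cutTF P Q) (sym (count-sum P))
                    (subst (sumFin (λ w → ind (P w)) ≤_) (sym cutTF≡) (sum-mono ind≤out))

    split≤d : cutTF P Q + cutFT P Q ≤ d
    split≤d = subst (_≤ d) (cut-split P Q) tight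

    -- the chain  d ≤ p ≤ cutTF ≤ cutTF + cutFT ≤ d  collapses
    p≡d : p ≡ d
    p≡d = NP.≤-antisym (NP.≤-trans p≤cutTF (NP.≤-trans (NP.m≤m+n _ _) split≤d)) d≤p

    cutFT≡0 : cutFT P Q ≡ 0
    cutFT≡0 = NP.n≤0⇒n≡0 (NP.+-cancelˡ-≤ (cutTF P Q) _ _
      (subst (cutTF P Q + cutFT P Q ≤_) (sym (NP.+-identityʳ (cutTF P Q)))
             (NP.≤-trans split≤d (NP.≤-trans d≤p p≤cutTF))))

    out≡1 : ∀ w → P w ≡ true → out w ≡ 1
    out≡1 w pw = sym (subst (λ t → (if t then 1 else 0) ≡ (if t then out w else 0)) pw
      (sum-eq-pt ind≤out (subst (_≤ sumFin (λ w → ind (P w))) cutTF≡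
        (subst (cutTF P Q ≤_) (count-sum P) (NP.≤-trans (NP.m≤m+n _ _) (NP.≤-trans split≤d d≤p)))) w))

    -- hence d − q ≤ 1, i.e. q + 1 = d; then q' = d and n + 1 = 2d
    q+1≡d : suc q ≡ d
    q+1≡d = NP.≤-antisym q<d (NP.≤-trans (NP.m≤n+m∸n d q)
      (subst (λ t → q + (d ∸ q) ≤ t) (NP.+-comm q 1)
        (NP.+-monoʳ-≤ q (subst (d ∸ q ≤_) (out≡1 w pw) (out≥d∸q w)))))
      where
      witness : Σ (Fin n) (λ w → P w ≡ true)
      witness = count-witness P (NP.≤-trans 1≤d d≤p)
      w = proj₁ witness
      pw = proj₂ witness

    n+1≡d+q' : suc n ≡ d + q'
    n+1≡d+q' = trans (cong suc (sym (count-compl Q))) (cong (_+ q') q+1≡d)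

    q'≡d : q' ≡ d
    q'≡d = NP.≤-antisym (NP.+-cancelˡ-≤ d _ _ (subst (_≤ d + d) n+1≡d+q' n<2d)) d≤q'

    n+1≡2d : suc n ≡ d + d
    n+1≡2d = trans n+1≡d+q' (cong (d +_) q'≡d)

    -- cutFT = 0: no edge joins V∖P to Q, so N(w') ⊆ P for w' ∈ Q ...
    no-FT-pair : ∀ w w' → (A w w' ∧ (not (P w) ∧ Q w')) ≡ false
    no-FT-pair w w' = count-zero _ (sum-zero-pt _ cutFT≡0 w) w'

    Q-nbrs-in-P : ∀ w' w → Q w' ≡ true → A w' w ≡ true → P w ≡ true
    Q-nbrs-in-P w' w qw' aw with P w in eq
    ... | true  = refl
    ... | false with trans (sym (no-FT-pair w w')) (subst₂ (λ s t → (s ∧ (not t ∧ Q w')) ≡ true)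
                       (sym (trans (Graph.sym H w w') aw)) (sym eq) qw')
    ...   | ()

    -- ... and since deg w' ≥ d = |P|, in fact N(w') = P
    P-nbrs-of-Q : ∀ w' w → Q w' ≡ true → P w ≡ true → A w' w ≡ true
    P-nbrs-of-Q w' w qw' pw = count-eqsub {p = A w'} {q = P} (λ i → Q-nbrs-in-P w' i qw')
                                (subst (_≤ count (A w')) (sym p≡d) (δ-le H w')) w pw

    -- Q and P are disjoint (loops are absent), and |V∖P| = d − 1 = |Q|, so Q = V∖P
    Q-disjoint-P : ∀ w → Q w ≡ true → P w ≡ false
    Q-disjoint-P w qw with P w in eq
    ... | false = refl
    ... | true with trans (sym (loopless H w)) (P-nbrs-of-Q w w qw eq)
    ...   | ()

    p'≡q : p' ≡ q
    p'≡q = NP.+-cancelʳ-≡ d p' q (begin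
      p' + d      ≡⟨ NP.+-comm p' d ⟩
      d + p'      ≡⟨ cong (_+ p') (sym p≡d) ⟩
      p + p'      ≡⟨ count-compl P ⟩
      n           ≡⟨ sym (count-compl Q) ⟩
      q + q'      ≡⟨ cong (q +_) q'≡d ⟩
      q + d       ∎)
      where open ≡-Reasoning

    outside-P-is-Q : ∀ b → P b ≡ false → Q b ≡ true
    outside-P-is-Q b pb = count-eqsub {p = Q} {q = λ w → not (P w)}
      (λ i qi → cong not (Q-disjoint-P i qi)) (NP.≤-reflexive p'≡q) b (cong not pb)

    not-Q≡P : ∀ w → not (Q w) ≡ P w
    not-Q≡P w with P w in eq
    ... | false rewrite outside-P-is-Q w eq = refl
    ... | true with Q w in eq2
    ...   | false = refl
    ...   | true with trans (sym eq) (Q-disjoint-P w eq2)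
    ...     | ()

    structure : JoinStructure H
    structure = record
      { R = P ; k = d ; |R|≡k = p≡d ; n+1≡2k = n+1≡2d
      ; outside = λ b w pb → bool-ext (Q-nbrs-in-P b w (outside-P-is-Q b pb))
                                      (P-nbrs-of-Q b w (outside-P-is-Q b pb))
      ; matched = λ r pr → trans (count-ext (λ r' → trans (∧-comm (P r') (A r r'))
                                   (cong (A r r' ∧_) (sym (not-Q≡P r'))))) (out≡1 r pr) }

  -- If δ(H) = 2 then H = K₃, a join structure with R = V(H) ∖ {w₀}.
  module Triangle (d≡2 : d ≡ 2) (w₀ : Fin n) where
    n≡3 : n ≡ 3
    n≡3 = NP.≤-antisym (NP.≤-pred (subst (λ t → n < t + t) d≡2 n<2d)) (subst (_< n) d≡2 (δ<n H w₀))

    complete : ∀ w w' → w ≢ w' → A w w' ≡ true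
    complete w w' ne with A w w' in eq
    ... | true  = refl
    ... | false = ⊥-elim (NP.<-irrefl refl (NP.<-≤-trans
          (NP.+-mono-≤ {2} {degree H w} {2} {count (λ i → not (A w i))}
            (subst (_≤ degree H w) d≡2 (δ-le H w))
            (count-two (λ i → not (A w i)) w w' ne (cong not (loopless H w)) (cong not eq)))
          (subst (_≤ 3) (sym (count-compl (A w))) (NP.≤-reflexive n≡3))))

    adj≡≢ : ∀ r r' → A r r' ≡ not (r' == r)
    adj≡≢ r r' with r' == r in eq
    ... | true rewrite ==→≡ r' r eq = loopless H r
    ... | false = complete r r' (λ e → ==f→≢ r' r eq (sym e))

    R : Fin n → Bool
    R w = not (w == w₀)

    |R|≡2 : count R ≡ 2
    |R|≡2 = NP.+-cancelʳ-≡ 1 (count R) 2 (trans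
      (cong (count R +_) (sym (trans (count-ext (λ w → not-involutive (w == w₀))) (count-eq1 w₀))))
      (trans (count-compl R) n≡3))

    outside : ∀ b w → R b ≡ false → A b w ≡ R w
    outside b w rb rewrite ==→≡ b w₀ (not-false rb) = adj≡≢ w₀ w

    matched : ∀ r → R r ≡ true → count (λ r' → R r' ∧ A r r') ≡ 1
    matched r rr = NP.+-cancelˡ-≡ 2 _ 1
      (trans (cong (_+ count (λ r' → R r' ∧ A r r')) (sym (count-or2 w₀ r w₀≢r)))
        (trans (cong (count (λ i → (i == w₀) ∨ (i == r)) +_) (count-ext third)) (trans (count-compl _) n≡3)))
      where
      w₀≢r : w₀ ≢ r
      w₀≢r e = ==f→≢ r w₀ (not-true rr) (sym e)
      third : ∀ r' → (R r' ∧ A r r') ≡ not ((r' == w₀) ∨ (r' == r))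
      third r' rewrite adj≡≢ r r' with r' == w₀ | r' == r
      ... | true  | _     = refl
      ... | false | true  = refl
      ... | false | false = refl

    structure : JoinStructure H
    structure = record { R = R ; k = 2 ; |R|≡k = |R|≡2 ; n+1≡2k = cong suc n≡3
                       ; outside = outside ; matched = matched }

  -- A tight cut (≤ δ(H) pairs) between two non-constant sets yields a join
  -- structure on H: by the arithmetic classification it is one of the shapes
  -- above, up to replacing P, Q by their complements.
  tight-cut-structure : ∀ P Q (a b c e : Fin n) → P a ≡ true → P b ≡ false →
    Q c ≡ true → Q e ≡ false → cutH P Q ≤ d → JoinStructure H
  tight-cut-structure P Q a b c e pa pb qc qe tight
    with cut-counts-tight (cut-counts P Q a b pa pb) (count-pos Q c qc)
           (count-pos (λ w → not (Q w)) e (cong not qe)) (subst (_≤ d) (cut-split P Q) tight)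
  ... | large-P d≤p d≤q' = LargeTightCut.structure P Q d≤p d≤q' tight
  ... | small-P d≤p' d≤q = LargeTightCut.structure (λ w → not (P w)) (λ w → not (Q w)) d≤p'
          (subst (d ≤_) (sym (count-ext (λ w → not-involutive (Q w)))) d≤q)
          (subst (_≤ d) (sym (cut-compl P Q)) tight)
  ... | triangle d≡2 = Triangle.structure d≡2 a

enumerate : ∀ {n} (P : Fin n → Bool) → Fin (count P) → Fin n
enumerate {suc n} P i with P zero
enumerate {suc n} P zero    | true  = zero
enumerate {suc n} P (suc i) | true  = suc (enumerate (P ∘ suc) i)
enumerate {suc n} P i       | false = suc (enumerate (P ∘ suc) i)

enumerate-in : ∀ {n} (P : Fin n → Bool) (i : Fin (count P)) → P (enumerate P i) ≡ true
enumerate-in {suc n} P i with P zero in eq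
enumerate-in {suc n} P zero    | true  = eq
enumerate-in {suc n} P (suc i) | true  = enumerate-in (P ∘ suc) i
enumerate-in {suc n} P i       | false = enumerate-in (P ∘ suc) i

enumerate-injective : ∀ {n} (P : Fin n → Bool) (i j : Fin (count P)) →
                      enumerate P i ≡ enumerate P j → i ≡ j
enumerate-injective {suc n} P i j e with P zero
enumerate-injective {suc n} P zero    zero    e  | true = refl
enumerate-injective {suc n} P zero    (suc j) () | true
enumerate-injective {suc n} P (suc i) zero    () | true
enumerate-injective {suc n} P (suc i) (suc j) e  | true =
  cong suc (enumerate-injective (P ∘ suc) i j (FP.suc-injective e))
enumerate-injective {suc n} P i j e | false = enumerate-injective (P ∘ suc) i j (FP.suc-injective e)

injective⇒surjective : ∀ {k} (f : Fin k → Fin k) → (∀ x y → f x ≡ f y → x ≡ y) →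
                       ∀ y → Σ (Fin k) (λ x → f x ≡ y)
injective⇒surjective {suc k} f inj y with FP.any? (λ x → f x FP.≟ y)
... | yes hit = hit
... | no miss = ⊥-elim (NP.<-irrefl refl (FP.injective⇒≤ {f = squeeze}
      (λ {x} {x'} e → inj x x' (FP.punchOut-injective (avoids x) (avoids x') e))))
  where
  avoids : ∀ x → y ≢ f x
  avoids x e = miss (x , sym e)
  squeeze : Fin (suc k) → Fin k
  squeeze x = punchOut (avoids x)

first : ∀ {k} → (Fin k → Bool) → Maybe (Fin k)
first {zero}  P = nothing
first {suc k} P = if P zero then just zero else Maybe.map suc (first (P ∘ suc))

first-sound : ∀ {k} (P : Fin k → Bool) (j : Fin k) → first P ≡ just j → P j ≡ true
first-sound {suc k} P j e with P zero in eq
first-sound {suc k} P .zero refl | true = eq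
... | false with first (P ∘ suc) in e₂
first-sound {suc k} P .(suc j') refl | false | just j' = first-sound (P ∘ suc) j' e₂

first-complete : ∀ {k} (P : Fin k → Bool) (i : Fin k) → P i ≡ true → Σ (Fin k) (λ j → first P ≡ just j)
first-complete {suc k} P i e with P zero in eq
... | true = zero , refl
... | false with i
...   | zero with trans (sym eq) e
...     | ()
first-complete {suc k} P i e | false | suc i' with first-complete (P ∘ suc) i' e
...     | j , e' rewrite e' = suc j , refl

module JoinAdjacency (l : ℕ) where
  m : ℕ
  m = 2 * l ∸ 1

  left-left : ∀ i j → joinAdj l (i ↑ˡ 2 * l) (j ↑ˡ 2 * l) ≡ false
  left-left i j rewrite FP.splitAt-↑ˡ m i (2 * l) | FP.splitAt-↑ˡ m j (2 * l) = refl

  left-right : ∀ i s → joinAdj l (i ↑ˡ 2 * l) (m ↑ʳ s) ≡ true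
  left-right i s rewrite FP.splitAt-↑ˡ m i (2 * l) | FP.splitAt-↑ʳ m (2 * l) s = refl

  right-left : ∀ r j → joinAdj l (m ↑ʳ r) (j ↑ˡ 2 * l) ≡ true
  right-left r j rewrite FP.splitAt-↑ʳ m (2 * l) r | FP.splitAt-↑ˡ m j (2 * l) = refl

  right-right : ∀ r s → joinAdj l (m ↑ʳ r) (m ↑ʳ s) ≡
                        (not ⌊ r FP.≟ s ⌋ ∧ ⌊ toℕ r / 2 NP.≟ toℕ s / 2 ⌋)
  right-right r s rewrite FP.splitAt-↑ʳ m (2 * l) r | FP.splitAt-↑ʳ m (2 * l) s = refl

  Block : Fin (joinV l) → Set
  Block i = Σ (Fin m) (λ i' → i ≡ i' ↑ˡ 2 * l) ⊎ Σ (Fin (2 * l)) (λ r → i ≡ m ↑ʳ r)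

  block : ∀ i → Block i
  block i with splitAt m i in e
  ... | inj₁ i' = inj₁ (i' , sym (FP.splitAt⁻¹-↑ˡ e))
  ... | inj₂ r  = inj₂ (r , sym (FP.splitAt⁻¹-↑ʳ e))

-- The matching inside
-- R is an involution  partner;  choosing the smaller vertex of each matched
-- pair gives l pairs, so |R| = 2l and |V ∖ R| = 2l − 1.  The embedding sends
-- the i-th left vertex of the join to the i-th vertex outside R, and the right
-- vertex r to the (r / 2)-th chosen vertex or its partner, according to the
-- parity of r; it preserves adjacency and, being injective, is a bijection.
module JoinIso (H : Graph) (js : JoinStructure H) where
  open JoinStructure js
  n : ℕ
  n = V H
  A : Fin n → Fin n → Bool
  A = Adj H

  -- the partner of r ∈ R: its unique neighbour in R (other vertices are fixed)
  partner : Fin n → Fin n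
  partner w = if R w then fromMaybe w (first (λ r' → R r' ∧ A w r')) else w

  partner-spec : ∀ r → R r ≡ true → (R (partner r) ∧ A r (partner r)) ≡ true
  partner-spec r rr with count-witness (λ r' → R r' ∧ A r r') (NP.≤-reflexive (sym (matched r rr)))
  ... | i , qi with first-complete (λ r' → R r' ∧ A r r') i qi
  ...   | j , ej rewrite rr | ej = first-sound (λ r' → R r' ∧ A r r') j ej

  partner-in-R : ∀ r → R r ≡ true → R (partner r) ≡ true
  partner-in-R r rr = proj₁ (∧-true (partner-spec r rr))

  partner-adj : ∀ r → R r ≡ true → A r (partner r) ≡ true
  partner-adj r rr = proj₂ (∧-true {R (partner r)} (partner-spec r rr))

  partner-unique : ∀ r r' → R r ≡ true → R r' ≡ true → A r r' ≡ true → r' ≡ partner r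
  partner-unique r r' rr rr' ar with r' FP.≟ partner r
  ... | yes e = e
  ... | no ne = ⊥-elim (NP.<-irrefl refl (subst (2 ≤_) (matched r rr)
        (count-two (λ r'' → R r'' ∧ A r r'') r' (partner r) ne
           (subst (λ t → (t ∧ A r r') ≡ true) (sym rr') ar) (partner-spec r rr))))

  partner-outside : ∀ w → R w ≡ false → partner w ≡ w
  partner-outside w e rewrite e = refl

  partner-involutive : ∀ w → partner (partner w) ≡ w
  partner-involutive w with true-or-false (R w)
  ... | inj₁ e = sym (partner-unique (partner w) w (partner-in-R w e) e
                   (trans (Graph.sym H (partner w) w) (partner-adj w e)))
  ... | inj₂ e = trans (cong partner (partner-outside w e)) (partner-outside w e)

  partner-≢ : ∀ r → R r ≡ true → partner r ≢ r
  partner-≢ r rr e with trans (sym (loopless H r)) (subst (λ t → A r t ≡ true) e (partner-adj r rr))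
  ... | ()

  R-partner : ∀ w → R (partner w) ≡ R w
  R-partner w with true-or-false (R w)
  ... | inj₁ e = trans (partner-in-R w e) (sym e)
  ... | inj₂ e = cong R (partner-outside w e)

  _<ᵇ_ : Fin n → Fin n → Bool
  w <ᵇ v = ⌊ toℕ w NP.<? toℕ v ⌋

  <ᵇ-flip : ∀ w v → w ≢ v → not (w <ᵇ v) ≡ (v <ᵇ w)
  <ᵇ-flip w v ne with toℕ w NP.<? toℕ v | toℕ v NP.<? toℕ w
  ... | yes a | yes b = ⊥-elim (NP.<-asym a b)
  ... | yes a | no b  = refl
  ... | no a  | yes b = refl
  ... | no a  | no b  = ⊥-elim (ne (FP.toℕ-injective (NP.≤-antisym (NP.≮⇒≥ b) (NP.≮⇒≥ a))))

  lower : Fin n → Bool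
  lower w = R w ∧ (w <ᵇ partner w)

  l : ℕ
  l = count lower

  upper≡lower∘partner : ∀ w → (R w ∧ not (w <ᵇ partner w)) ≡ lower (partner w)
  upper≡lower∘partner w with true-or-false (R w)
  ... | inj₂ e = trans (cong (λ t → t ∧ not (w <ᵇ partner w)) e)
                       (sym (cong (λ t → t ∧ (partner w <ᵇ partner (partner w))) (trans (R-partner w) e)))
  ... | inj₁ e = trans (cong (λ t → t ∧ not (w <ᵇ partner w)) e)
      (trans (<ᵇ-flip w (partner w) (λ q → partner-≢ w e (sym q)))
        (sym (trans (cong (λ t → t ∧ (partner w <ᵇ partner (partner w))) (trans (R-partner w) e))
                    (cong (partner w <ᵇ_) (partner-involutive w)))))

  -- |R| = 2l: the upper vertices are the partners of the lower ones
  |R|≡2l : count R ≡ l + l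
  |R|≡2l = trans (count-split R (λ w → w <ᵇ partner w))
    (cong (l +_) (trans (count-ext upper≡lower∘partner) (count-involution lower partner partner-involutive)))

  lower-partner : ∀ w → lower w ≡ true → lower (partner w) ≡ false
  lower-partner w e = trans (sym (upper≡lower∘partner w))
    (cong₂ (λ u v → u ∧ not v) (proj₁ (∧-true e)) (proj₂ (∧-true {R w} e)))

  representative : Fin n → Fin n
  representative w = if lower w then w else partner w

  representative-self : ∀ w → lower w ≡ true → representative w ≡ w
  representative-self w e rewrite e = refl

  representative-partner : ∀ w → lower w ≡ true → representative (partner w) ≡ w
  representative-partner w e rewrite lower-partner w e = partner-involutive w

  representative-pair : ∀ x → R x ≡ true → representative (partner x) ≡ representative x
  representative-pair x rx with true-or-false (lower x)
  ... | inj₁ e = trans (representative-partner x e) (sym (representative-self x e))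
  ... | inj₂ e = trans (representative-self (partner x) partner-lower)
                       (sym (subst (λ t → (if t then x else partner x) ≡ partner x) (sym e) refl))
    where
    not-below : (x <ᵇ partner x) ≡ false
    not-below = trans (sym (cong (λ t → t ∧ (x <ᵇ partner x)) rx)) e
    partner-lower : lower (partner x) ≡ true
    partner-lower = trans (sym (upper≡lower∘partner x)) (cong₂ (λ u v → u ∧ not v) rx not-below)

  representative-adj : ∀ x y → R x ≡ true → R y ≡ true → A x y ≡ true →
                       representative x ≡ representative y
  representative-adj x y rx ry ax rewrite partner-unique x y rx ry ax = sym (representative-pair x rx)

  outsideR : Fin n → Bool
  outsideR w = not (R w)

  k≡2l : k ≡ l + l
  k≡2l = trans (sym |R|≡k) |R|≡2l

  |outside|+1≡2l : suc (count outsideR) ≡ l + l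
  |outside|+1≡2l = NP.+-cancelˡ-≡ (l + l) _ _ (trans (NP.+-suc (l + l) (count outsideR))
    (trans (cong suc (trans (cong (_+ count outsideR) (sym |R|≡2l)) (count-compl R)))
      (trans n+1≡2k (cong₂ _+_ k≡2l k≡2l))))

  1≤l : 1 ≤ l
  1≤l with l | |outside|+1≡2l
  ... | suc _ | _ = s≤s z≤n

  2l≡l+l : 2 * l ≡ l + l
  2l≡l+l = cong (l +_) (NP.+-identityʳ l)

  |outside|≡2l-1 : 2 * l ∸ 1 ≡ count outsideR
  |outside|≡2l-1 = cong (_∸ 1) (trans 2l≡l+l (sym |outside|+1≡2l))

  joinV≡n : joinV l ≡ n
  joinV≡n = trans (cong₂ _+_ |outside|≡2l-1 2l≡l+l)
    (trans (NP.+-comm (count outsideR) (l + l)) (trans (cong (_+ count outsideR) (sym |R|≡2l)) (count-compl R)))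

  half<l : ∀ t → t < 2 * l → t / 2 < l
  half<l t lt with t / 2 NP.<? l
  ... | yes h = h
  ... | no h = ⊥-elim (NP.<-irrefl refl (NP.<-≤-trans lt (NP.≤-trans (NP.≤-reflexive (NP.*-comm 2 l))
                 (NP.≤-trans (NP.*-monoˡ-≤ 2 (NP.≮⇒≥ h)) (m/n*n≤m t 2)))))

  pair-index : Fin (2 * l) → Fin l
  pair-index r = fromℕ< (half<l (toℕ r) (FP.toℕ<n r))

  pair-index-toℕ : ∀ r → toℕ (pair-index r) ≡ toℕ r / 2
  pair-index-toℕ r = FP.toℕ-fromℕ< (half<l (toℕ r) (FP.toℕ<n r))

  nonzero : ℕ → Bool
  nonzero zero    = false
  nonzero (suc _) = true

  odd : Fin (2 * l) → Bool
  odd r = nonzero (toℕ r % 2)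

  nonzero-injective : ∀ a b → a < 2 → b < 2 → nonzero a ≡ nonzero b → a ≡ b
  nonzero-injective zero          zero          _ _ _ = refl
  nonzero-injective (suc zero)    (suc zero)    _ _ _ = refl
  nonzero-injective (suc (suc a)) _             (s≤s (s≤s ())) _ _
  nonzero-injective _             (suc (suc b)) _ (s≤s (s≤s ())) _

  right-determined : ∀ (r s : Fin (2 * l)) → toℕ r / 2 ≡ toℕ s / 2 →
                     odd r ≡ odd s → r ≡ s
  right-determined r s e-half e-odd = FP.toℕ-injective (begin
    toℕ r                        ≡⟨ m≡m%n+[m/n]*n (toℕ r) 2 ⟩
    toℕ r % 2 + toℕ r / 2 * 2    ≡⟨ cong₂ (λ u v → u + v * 2)
                                      (nonzero-injective _ _ (m%n<n (toℕ r) 2) (m%n<n (toℕ s) 2) e-odd) e-half ⟩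
    toℕ s % 2 + toℕ s / 2 * 2    ≡⟨ sym (m≡m%n+[m/n]*n (toℕ s) 2) ⟩
    toℕ s                        ∎)
    where open ≡-Reasoning

  flip : Bool → Fin n → Fin n
  flip b w = if b then partner w else w

  embedˡ : Fin (2 * l ∸ 1) → Fin n
  embedˡ i = enumerate outsideR (cast |outside|≡2l-1 i)

  pair-rep : Fin (2 * l) → Fin n
  pair-rep r = enumerate lower (pair-index r)

  embedʳ : Fin (2 * l) → Fin n
  embedʳ r = flip (odd r) (pair-rep r)

  embed : Fin (joinV l) → Fin n
  embed i = [ embedˡ , embedʳ ]′ (splitAt (2 * l ∸ 1) i)

  embedˡ-outside : ∀ i → R (embedˡ i) ≡ false
  embedˡ-outside i = not-true (enumerate-in outsideR (cast |outside|≡2l-1 i))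

  pair-rep-lower : ∀ r → lower (pair-rep r) ≡ true
  pair-rep-lower r = enumerate-in lower (pair-index r)

  pair-rep-R : ∀ r → R (pair-rep r) ≡ true
  pair-rep-R r = proj₁ (∧-true (pair-rep-lower r))

  flip-R : ∀ b w → R w ≡ true → R (flip b w) ≡ true
  flip-R true  w e = partner-in-R w e
  flip-R false w e = e

  flip-representative : ∀ b w → lower w ≡ true → representative (flip b w) ≡ w
  flip-representative true  w e = representative-partner w e
  flip-representative false w e = representative-self w e

  flip-adj : ∀ b₁ b₂ w → R w ≡ true → b₁ ≢ b₂ → A (flip b₁ w) (flip b₂ w) ≡ true
  flip-adj true  true  w e ne = ⊥-elim (ne refl)
  flip-adj false false w e ne = ⊥-elim (ne refl)
  flip-adj true  false w e ne = trans (Graph.sym H (partner w) w) (partner-adj w e)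
  flip-adj false true  w e ne = partner-adj w e

  flip-injective : ∀ b₁ b₂ w → R w ≡ true → flip b₁ w ≡ flip b₂ w → b₁ ≡ b₂
  flip-injective true  true  w e q = refl
  flip-injective false false w e q = refl
  flip-injective true  false w e q = ⊥-elim (partner-≢ w e q)
  flip-injective false true  w e q = ⊥-elim (partner-≢ w e (sym q))

  embedʳ-R : ∀ r → R (embedʳ r) ≡ true
  embedʳ-R r = flip-R (odd r) (pair-rep r) (pair-rep-R r)

  same-pair : ∀ (r s : Fin (2 * l)) → toℕ r / 2 ≡ toℕ s / 2 → pair-rep r ≡ pair-rep s
  same-pair r s e = cong (enumerate lower)
    (FP.toℕ-injective (trans (pair-index-toℕ r) (trans e (sym (pair-index-toℕ s)))))

  representative-embedʳ : ∀ (r s : Fin (2 * l)) → representative (embedʳ r) ≡ representative (embedʳ s) →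
                          toℕ r / 2 ≡ toℕ s / 2
  representative-embedʳ r s e = trans (sym (pair-index-toℕ r)) (trans (cong toℕ
    (enumerate-injective lower (pair-index r) (pair-index s)
      (trans (sym (flip-representative (odd r) (pair-rep r) (pair-rep-lower r)))
        (trans e (flip-representative (odd s) (pair-rep s) (pair-rep-lower s))))))
    (pair-index-toℕ s))

  non-adjacent-pairs : ∀ x y → R x ≡ true → R y ≡ true → representative x ≢ representative y → A x y ≡ false
  non-adjacent-pairs x y rx ry ne with true-or-false (A x y)
  ... | inj₂ e = e
  ... | inj₁ e = ⊥-elim (ne (representative-adj x y rx ry e))

  right-right-adj : ∀ r s (d₁ : Dec (r ≡ s)) (d₂ : Dec (toℕ r / 2 ≡ toℕ s / 2)) →
                    A (embedʳ r) (embedʳ s) ≡ (not ⌊ d₁ ⌋ ∧ ⌊ d₂ ⌋)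
  right-right-adj r s d₁ (no ne) = trans (non-adjacent-pairs (embedʳ r) (embedʳ s) (embedʳ-R r) (embedʳ-R s)
    (λ e → ne (representative-embedʳ r s e))) (sym (∧-zeroʳ _))
  right-right-adj r s (yes refl) (yes _) = loopless H (embedʳ r)
  right-right-adj r s (no r≢s) (yes e) = subst (λ t → A (embedʳ r) (flip (odd s) t) ≡ true) (same-pair r s e)
    (flip-adj (odd r) (odd s) (pair-rep r) (pair-rep-R r) (λ e' → r≢s (right-determined r s e e')))

  embedʳ-injective : ∀ r s → embedʳ r ≡ embedʳ s → r ≡ s
  embedʳ-injective r s e = right-determined r s e-half
    (flip-injective (odd r) (odd s) (pair-rep r) (pair-rep-R r)
      (trans e (cong (flip (odd s)) (sym (same-pair r s e-half)))))
    where
    e-half : toℕ r / 2 ≡ toℕ s / 2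
    e-half = representative-embedʳ r s (cong representative e)

  embedˡ-injective : ∀ i j → embedˡ i ≡ embedˡ j → i ≡ j
  embedˡ-injective i j e = FP.toℕ-injective (trans (sym (FP.toℕ-cast |outside|≡2l-1 i))
    (trans (cong toℕ (enumerate-injective outsideR (cast |outside|≡2l-1 i) (cast |outside|≡2l-1 j) e))
           (FP.toℕ-cast |outside|≡2l-1 j)))

  embedˡ≢embedʳ : ∀ i r → embedˡ i ≢ embedʳ r
  embedˡ≢embedʳ i r e with trans (sym (embedˡ-outside i)) (trans (cong R e) (embedʳ-R r))
  ... | ()

  open JoinAdjacency l using (Block; block; left-left; left-right; right-left; right-right)

  embed-left : ∀ i' i → i ≡ i' ↑ˡ 2 * l → embed i ≡ embedˡ i'
  embed-left i' i refl = cong [ embedˡ , embedʳ ]′ (FP.splitAt-↑ˡ (2 * l ∸ 1) i' (2 * l))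

  embed-right : ∀ r i → i ≡ (2 * l ∸ 1) ↑ʳ r → embed i ≡ embedʳ r
  embed-right r i refl = cong [ embedˡ , embedʳ ]′ (FP.splitAt-↑ʳ (2 * l ∸ 1) (2 * l) r)

  embed-adj : ∀ i j → A (embed i) (embed j) ≡ joinAdj l i j
  embed-adj i j = by-blocks (block i) (block j)
    where
    by-blocks : Block i → Block j → A (embed i) (embed j) ≡ joinAdj l i j
    by-blocks (inj₁ (i' , refl)) (inj₁ (j' , refl)) =
      trans (cong₂ A (embed-left i' _ refl) (embed-left j' _ refl))
        (trans (trans (outside _ _ (embedˡ-outside i')) (embedˡ-outside j')) (sym (left-left i' j')))
    by-blocks (inj₁ (i' , refl)) (inj₂ (s , refl)) =
      trans (cong₂ A (embed-left i' _ refl) (embed-right s _ refl))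
        (trans (trans (outside _ _ (embedˡ-outside i')) (embedʳ-R s)) (sym (left-right i' s)))
    by-blocks (inj₂ (r , refl)) (inj₁ (j' , refl)) =
      trans (cong₂ A (embed-right r _ refl) (embed-left j' _ refl))
        (trans (trans (Graph.sym H (embedʳ r) (embedˡ j')) (trans (outside _ _ (embedˡ-outside j')) (embedʳ-R r)))
               (sym (right-left r j')))
    by-blocks (inj₂ (r , refl)) (inj₂ (s , refl)) =
      trans (cong₂ A (embed-right r _ refl) (embed-right s _ refl))
        (trans (right-right-adj r s (r FP.≟ s) (toℕ r / 2 NP.≟ toℕ s / 2)) (sym (right-right r s)))

  embed-injective : ∀ i j → embed i ≡ embed j → i ≡ j
  embed-injective i j = by-blocks (block i) (block j)
    where
    by-blocks : Block i → Block j → embed i ≡ embed j → i ≡ j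
    by-blocks (inj₁ (i' , refl)) (inj₁ (j' , refl)) e = cong (_↑ˡ 2 * l)
      (embedˡ-injective i' j' (trans (sym (embed-left i' _ refl)) (trans e (embed-left j' _ refl))))
    by-blocks (inj₁ (i' , refl)) (inj₂ (s , refl)) e = ⊥-elim (embedˡ≢embedʳ i' s
      (trans (sym (embed-left i' _ refl)) (trans e (embed-right s _ refl))))
    by-blocks (inj₂ (r , refl)) (inj₁ (j' , refl)) e = ⊥-elim (embedˡ≢embedʳ j' r
      (sym (trans (sym (embed-right r _ refl)) (trans e (embed-left j' _ refl)))))
    by-blocks (inj₂ (r , refl)) (inj₂ (s , refl)) e = cong ((2 * l ∸ 1) ↑ʳ_)
      (embedʳ-injective r s (trans (sym (embed-right r _ refl)) (trans e (embed-right s _ refl))))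

  -- embed is an injection between sets of equal size, hence has an inverse
  cast-injective : ∀ {a b} (q : a ≡ b) (x y : Fin a) → cast q x ≡ cast q y → x ≡ y
  cast-injective q x y e = FP.toℕ-injective (trans (sym (FP.toℕ-cast q x)) (trans (cong toℕ e) (FP.toℕ-cast q y)))

  embed-onto : ∀ y → Σ (Fin (joinV l)) (λ x → cast (sym joinV≡n) (embed x) ≡ cast (sym joinV≡n) y)
  embed-onto y = injective⇒surjective (λ x → cast (sym joinV≡n) (embed x))
    (λ x x' e → embed-injective x x' (cast-injective (sym joinV≡n) (embed x) (embed x') e)) (cast (sym joinV≡n) y)

  to : Fin n → Fin (joinV l)
  to y = proj₁ (embed-onto y)

  embed-to : ∀ y → embed (to y) ≡ y
  embed-to y = cast-injective (sym joinV≡n) (embed (to y)) y (proj₂ (embed-onto y))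

  to-embed : ∀ x → to (embed x) ≡ x
  to-embed x = embed-injective (to (embed x)) x (embed-to (embed x))

  isomorphism : Σ ℕ (λ l' → 1 ≤ l' × IsoToJoin H l')
  isomorphism = l , 1≤l , mk↔ₛ′ to embed to-embed embed-to ,
    λ x y → trans (cong₂ A (sym (embed-to x)) (sym (embed-to y))) (embed-adj (to x) (to y))

join-structure-iso : ∀ H → JoinStructure H → Σ ℕ (λ l → 1 ≤ l × IsoToJoin H l)
join-structure-iso H js = JoinIso.isomorphism H js

_==ᵖ_ : ∀ {a b} → Fin a × Fin b → Fin a × Fin b → Bool
(x , u) ==ᵖ (y , v) = (x == y) ∧ (u == v)

==ᵖ-refl : ∀ {a b} (c : Fin a × Fin b) → (c ==ᵖ c) ≡ true
==ᵖ-refl (x , u) rewrite ==-refl x | ==-refl u = refl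

==ᵖ→≡ : ∀ {a b} (c c' : Fin a × Fin b) → (c ==ᵖ c') ≡ true → c ≡ c'
==ᵖ→≡ (x , u) (y , v) e with ∧-true {x == y} e
... | ex , eu rewrite ==→≡ x y ex | ==→≡ u v eu = refl

anyFin : ∀ {n} → (Fin n → Bool) → Bool
anyFin {zero}  p = false
anyFin {suc n} p = p zero ∨ anyFin (p ∘ suc)

anyFin-intro : ∀ {n} (p : Fin n → Bool) (i : Fin n) → p i ≡ true → anyFin p ≡ true
anyFin-intro p zero    e rewrite e = refl
anyFin-intro p (suc i) e = ∨-trueʳ (p zero) (anyFin-intro (p ∘ suc) i e)

anyFin-elim : ∀ {n} (p : Fin n → Bool) → anyFin p ≡ true → Σ (Fin n) (λ i → p i ≡ true)
anyFin-elim {suc n} p e with p zero in eq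
... | true  = zero , eq
... | false with anyFin-elim (p ∘ suc) e
...   | i , e' = suc i , e'

anyFin-false : ∀ {n} (p : Fin n → Bool) → anyFin p ≡ false → ∀ i → p i ≡ false
anyFin-false p e i with p i in eq
... | false = refl
... | true with trans (sym e) (anyFin-intro p i eq)
...   | ()

snoc : ∀ {A : Set} {E : A → A → Bool} {s a c} → Reach E s a → E a c ≡ true → Reach E s c
snoc here         e = step e here
snoc (step e' r) e = step e' (snoc r e)

-- It is computed by iterating  R ↦ R ∪ N(R)  from {s}; each iteration that
-- does not stop adds a vertex, so a × b + 1 iterations suffice.
module Closure (a b : ℕ) (E : Fin a × Fin b → Fin a × Fin b → Bool) (s : Fin a × Fin b) where
  Vtx : Set
  Vtx = Fin a × Fin b

  anyVtx : (Vtx → Bool) → Bool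
  anyVtx f = anyFin (λ x → anyFin (λ u → f (x , u)))

  anyVtx-intro : ∀ f c → f c ≡ true → anyVtx f ≡ true
  anyVtx-intro f (x , u) e = anyFin-intro _ x (anyFin-intro _ u e)

  anyVtx-elim : ∀ f → anyVtx f ≡ true → Σ Vtx (λ c → f c ≡ true)
  anyVtx-elim f e with anyFin-elim _ e
  ... | x , e' with anyFin-elim _ e'
  ...   | u , e'' = (x , u) , e''

  countVtx : (Vtx → Bool) → ℕ
  countVtx R = sumFin (λ x → count (λ u → R (x , u)))

  countVtx-le : ∀ R → countVtx R ≤ a * b
  countVtx-le R = sum-ub {a} b (λ x → count-le (λ u → R (x , u)))

  countVtx-strict : ∀ R R' (c : Vtx) → (∀ c' → R c' ≡ true → R' c' ≡ true) →
                    R' c ≡ true → R c ≡ false → countVtx R < countVtx R'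
  countVtx-strict R R' (x , u) h r' r =
    sum-strict x (λ y → count-mono (λ v → h (y , v))) (count-strict u (λ v → h (x , v)) r' r)

  extend : (Vtx → Bool) → Vtx → Bool
  extend R c = R c ∨ anyVtx (λ a' → R a' ∧ E a' c)

  extend-⊇ : ∀ R c → R c ≡ true → extend R c ≡ true
  extend-⊇ R c e rewrite e = refl

  ball : ℕ → Vtx → Bool
  ball zero    = s ==ᵖ_
  ball (suc k) = extend (ball k)

  ball-centre : ∀ k → ball k s ≡ true
  ball-centre zero    = ==ᵖ-refl s
  ball-centre (suc k) = extend-⊇ (ball k) s (ball-centre k)

  ball-reach : ∀ k c → ball k c ≡ true → Reach E s c
  ball-reach zero c e rewrite ==ᵖ→≡ s c e = here
  ball-reach (suc k) c e with ball k c in eq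
  ... | true  = ball-reach k c eq
  ... | false with anyVtx-elim (λ a' → ball k a' ∧ E a' c) e
  ...   | a' , e' with ∧-true {ball k a'} e'
  ...     | in-ball , edge = snoc (ball-reach k a' in-ball) edge

  Closed : (Vtx → Bool) → Set
  Closed R = ∀ a' c → R a' ≡ true → E a' c ≡ true → R c ≡ true

  new : (Vtx → Bool) → Vtx → Bool
  new R c = extend R c ∧ not (R c)

  no-new-closed : ∀ R → anyVtx (new R) ≡ false → Closed R
  no-new-closed R none a' c ra ec =
    already-in (anyFin-false _ (anyFin-false _ none (proj₁ c)) (proj₂ c)) grows
    where
    grows : extend R c ≡ true
    grows = ∨-trueʳ (R c) (anyVtx-intro (λ a'' → R a'' ∧ E a'' c) a'
              (subst (λ t → (t ∧ E a' c) ≡ true) (sym ra) ec))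
    already-in : ∀ {x y} → (x ∧ not y) ≡ false → x ≡ true → y ≡ true
    already-in {true} {true} _ _ = refl

  -- iterate while the ball grows; the fuel bounds the remaining growth
  stabilise : ∀ fuel k → a * b < fuel + countVtx (ball k) → Σ ℕ (λ j → Closed (ball j))
  stabilise zero k lt = ⊥-elim (NP.<-irrefl refl (NP.<-≤-trans lt (countVtx-le (ball k))))
  stabilise (suc f) k lt with anyVtx (new (ball k)) in eb
  ... | false = k , no-new-closed (ball k) eb
  ... | true with anyVtx-elim (new (ball k)) eb
  ...   | c , e with ∧-true {extend (ball k) c} e
  ...     | in-next , not-in = stabilise f (suc k) (NP.<-≤-trans lt
            (subst (_≤ f + countVtx (ball (suc k))) (NP.+-suc f (countVtx (ball k)))
              (NP.+-monoʳ-≤ f (countVtx-strict (ball k) (ball (suc k)) c (extend-⊇ (ball k))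
                 in-next (not-true not-in)))))

  component : Σ (Vtx → Bool) (λ C → (C s ≡ true) × Closed C × (∀ c → C c ≡ true → Reach E s c))
  component with stabilise (suc (a * b)) 0 (s≤s (NP.m≤m+n (a * b) _))
  ... | j , closed = ball j , ball-centre j , closed , ball-reach j

≤half : ∀ K m → K + K ≤ m → K ≤ m / 2
≤half K m le = subst (_≤ m / 2) (m*n/n≡m K 2) (/-monoˡ-≤ 2 (subst (_≤ m) (double K) le))
  where
  double : ∀ K → K + K ≡ K * 2
  double = solve-∀

≤2half+1 : ∀ m → m ≤ suc (m / 2 + m / 2)
≤2half+1 m = subst (_≤ suc (m / 2 + m / 2)) (sym (m≡m%n+[m/n]*n m 2))
  (subst (m % 2 + m / 2 * 2 ≤_) (double+1 (m / 2)) (NP.+-monoˡ-≤ (m / 2 * 2) (NP.≤-pred (m%n<n m 2))))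
  where
  double+1 : ∀ k → 1 + k * 2 ≡ suc (k + k)
  double+1 = solve-∀

no-room : ∀ {K m e} → K + K + e ≤ m → m / 2 ≤ K → 2 ≤ e → ⊥
no-room {K} {m} {e} le half≤K 2≤e = NP.<-irrefl refl (NP.<-≤-trans
    (NP.≤-trans (NP.≤-reflexive (reorder (m / 2))) (NP.+-mono-≤ (NP.+-mono-≤ half≤K half≤K) 2≤e))
    (NP.≤-trans le (≤2half+1 m)))
  where
  reorder : ∀ c → suc (suc (c + c)) ≡ c + c + 2
  reorder = solve-∀

-- For a vertex set C of G × H, the crossing pairs
-- (ordered pairs of adjacent vertices exactly one of which lies in C) are
-- grouped by the edge xy of G they lie over: over xy they form the bipartite
-- cut of H between the traces of C on the fibres of x and y.
module DoubleCount (G H : Graph) (S : EdgeSet G H) (n<2d : V H < δ H + δ H) where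
  open BipartiteCut H
  open CutBound H n<2d

  Vtx : Set
  Vtx = PV G H

  pairs : (Vtx → Vtx → Bool) → ℕ
  pairs f = sumFin {V G} (λ z → sumFin {V H} (λ w → sumFin {V G} (λ y → count {V H} (λ w' → f (z , w) (y , w')))))

  pairs-mono : ∀ {f g : Vtx → Vtx → Bool} → (∀ a b → f a b ≡ true → g a b ≡ true) → pairs f ≤ pairs g
  pairs-mono h = sum-mono (λ z → sum-mono (λ w → sum-mono (λ y → count-mono (λ w' → h (z , w) (y , w')))))

  pairs-strict : ∀ {f g : Vtx → Vtx → Bool} → (∀ a b → f a b ≡ true → g a b ≡ true) →
    ∀ a₀ b₀ → g a₀ b₀ ≡ true → f a₀ b₀ ≡ false → pairs f < pairs g
  pairs-strict h (z , w) (y , w') ga fa =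
    sum-strict z (λ z' → sum-mono (λ w'' → sum-mono (λ y' → count-mono (λ w''' → h (z' , w'') (y' , w''')))))
      (sum-strict w (λ w'' → sum-mono (λ y' → count-mono (λ w''' → h (z , w'') (y' , w'''))))
        (sum-strict y (λ y' → count-mono (λ w''' → h (z , w) (y' , w''')))
          (count-strict w' (λ w''' → h (z , w) (y , w''')) ga fa)))

  trace : (Vtx → Bool) → Fin (V G) → Fin (V H) → Bool
  trace C z w = C (z , w)

  crossing : (Vtx → Bool) → Vtx → Vtx → Bool
  crossing C a b = prodAdj G H a b ∧ (C a xor C b)

  fibreCut : (Vtx → Bool) → Fin (V G) → Fin (V G) → ℕ
  fibreCut C z y = if Adj G z y then cutH (trace C z) (trace C y) else 0

  cutsAt : (Vtx → Bool) → Fin (V G) → ℕ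
  cutsAt C x = sumFin (fibreCut C x)

  crossing≡fibreCuts : ∀ C → pairs (crossing C) ≡ sumFin (λ z → sumFin (fibreCut C z))
  crossing≡fibreCuts C = sum-ext (λ z → trans (sum-swap (λ w y → count (λ w' → crossing C (z , w) (y , w'))))
                                            (sum-ext (λ y → over z y)))
    where
    over : ∀ z y → sumFin {V H} (λ w → count {V H} (λ w' → crossing C (z , w) (y , w'))) ≡ fibreCut C z y
    over z y with Adj G z y
    ... | true  = refl
    ... | false = trans (sum-ext {V H} (λ w → count-false {V H})) (trans (sum-const {V H} 0) (NP.*-zeroʳ (V H)))

  fibreCut-sym : ∀ C z y → fibreCut C z y ≡ fibreCut C y z
  fibreCut-sym C z y rewrite Graph.sym G z y with Adj G y z
  ... | true  = cut-sym (trace C z) (trace C y)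
  ... | false = refl

  fibreCut-diag : ∀ C x → fibreCut C x x ≡ 0
  fibreCut-diag C x rewrite loopless G x = refl

  -- the pairs leaving and the pairs entering the fibre of x are both counted
  two-cutsAt≤crossing : ∀ C x → cutsAt C x + cutsAt C x ≤ pairs (crossing C)
  two-cutsAt≤crossing C x = subst (cutsAt C x + cutsAt C x ≤_) (sym (crossing≡fibreCuts C))
    (subst (λ t → cutsAt C x + t ≤ sumFin (λ z → sumFin (fibreCut C z))) (sum-ext (λ z → fibreCut-sym C z x))
      (sum-pick (λ z → sumFin (fibreCut C z)) (λ z → fibreCut C z x) x (fibreCut-diag C x)
        (λ z _ → sum-point _ x)))

  two-cutsAt+other≤crossing : ∀ C x y₀ z₀ → y₀ ≢ x → z₀ ≢ x →
    cutsAt C x + cutsAt C x + fibreCut C y₀ z₀ ≤ pairs (crossing C)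
  two-cutsAt+other≤crossing C x y₀ z₀ y₀≢x z₀≢x =
    subst (cutsAt C x + cutsAt C x + fibreCut C y₀ z₀ ≤_) (sym (crossing≡fibreCuts C))
      (subst (_≤ sumFin (λ z → sumFin (fibreCut C z))) (sym (NP.+-assoc (cutsAt C x) (cutsAt C x) (fibreCut C y₀ z₀)))
        (subst (λ t → cutsAt C x + t ≤ sumFin (λ z → sumFin (fibreCut C z))) column+other
          (sum-pick (λ z → sumFin (fibreCut C z)) h x h-at-x h-below)))
    where
    h : Fin (V G) → ℕ
    h z = fibreCut C z x + (if z == y₀ then fibreCut C y₀ z₀ else 0)
    h-at-x : h x ≡ 0
    h-at-x rewrite fibreCut-diag C x | ≢→==f x y₀ (λ e → y₀≢x (sym e)) = refl
    h-below : ∀ z → z ≢ x → h z ≤ sumFin (fibreCut C z)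
    h-below z _ with z == y₀ in e
    ... | true rewrite ==→≡ z y₀ e = sum-two (fibreCut C y₀) x z₀ (λ e' → z₀≢x (sym e'))
    ... | false = subst (_≤ sumFin (fibreCut C z)) (sym (NP.+-identityʳ _)) (sum-point (fibreCut C z) x)
    column+other : sumFin h ≡ cutsAt C x + fibreCut C y₀ z₀
    column+other = trans (sum-+ (λ z → fibreCut C z x) (λ z → if z == y₀ then fibreCut C y₀ z₀ else 0))
      (cong₂ _+_ (sum-ext (λ z → fibreCut-sym C z x)) (sum-single y₀ (fibreCut C y₀ z₀)))

  Separates : (Vtx → Bool) → Set
  Separates C = ∀ a b → crossing C a b ≡ true → mem S a b ≡ true

  cutsAt≤card : ∀ C x → Separates C → cutsAt C x ≤ card S
  cutsAt≤card C x sep = ≤half (cutsAt C x) (orderedCount S)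
    (NP.≤-trans (two-cutsAt≤crossing C x) (pairs-mono sep))

  fibreCut≥d : ∀ C x a b → C (x , a) ≡ true → C (x , b) ≡ false →
               ∀ y → (if Adj G x y then d else 0) ≤ fibreCut C x y
  fibreCut≥d C x a b pa pb y with Adj G x y
  ... | true  = cut-lower-bound (trace C x) (trace C y) a b pa pb
  ... | false = z≤n

  cutsAt≥deg*d : ∀ C x a b → C (x , a) ≡ true → C (x , b) ≡ false → degree G x * d ≤ cutsAt C x
  cutsAt≥deg*d C x a b pa pb = subst (_≤ cutsAt C x) (sum-ind-mul (Adj G x) d)
    (sum-mono (fibreCut≥d C x a b pa pb))

  separated-lower-bound : ∀ C x a b → Separates C → C (x , a) ≡ true → C (x , b) ≡ false →
                          δ G * d ≤ card S
  separated-lower-bound C x a b sep pa pb =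
    NP.≤-trans (NP.*-monoˡ-≤ d (δ-le G x)) (NP.≤-trans (cutsAt≥deg*d C x a b pa pb) (cutsAt≤card C x sep))

  prodAdj-sym : ∀ a b → prodAdj G H a b ≡ prodAdj G H b a
  prodAdj-sym (x , u) (y , v) rewrite Graph.sym G x y | Graph.sym H u v = refl

  prodAdj-loopless : ∀ p → prodAdj G H p p ≡ false
  prodAdj-loopless (x , u) rewrite loopless G x = refl

  Closed-S : (Vtx → Bool) → Set
  Closed-S C = ∀ a c → C a ≡ true → removeAdj G H S a c ≡ true → C c ≡ true

  leaving-in-S : ∀ C → Closed-S C → ∀ a b → prodAdj G H a b ≡ true → C a ≡ true → C b ≡ false →
                 mem S a b ≡ true
  leaving-in-S C closed a b ep ca cb with mem S a b in em
  ... | true = refl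
  ... | false with trans (sym cb) (closed a b ca (subst (λ t → (t ∧ not (mem S a b)) ≡ true) (sym ep) (cong not em)))
  ...   | ()

  closed-separates : ∀ C → Closed-S C → Separates C
  closed-separates C closed a b t with prodAdj G H a b in ep | C a in ca | C b in cb
  ... | true | true  | false = leaving-in-S C closed a b ep ca cb
  ... | true | false | true  =
    trans (memSym S a b) (leaving-in-S C closed b a (trans (prodAdj-sym b a) ep) cb ca)

  adjacent-≢ : ∀ x y → Adj G x y ≡ true → y ≢ x
  adjacent-≢ x y e refl with trans (sym (loopless G x)) e
  ... | ()

  module EqualityCase (C : Vtx → Bool) (sep : Separates C) (x : Fin (V G)) (a b : Fin (V H))
                      (pa : C (x , a) ≡ true) (pb : C (x , b) ≡ false) (card≡ : card S ≡ δ G * d) where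

    card≤cutsAt : ∀ C' → C' (x , a) ≡ true → C' (x , b) ≡ false → card S ≤ cutsAt C' x
    card≤cutsAt C' pa' pb' = subst (_≤ cutsAt C' x) (sym card≡)
      (NP.≤-trans (NP.*-monoˡ-≤ d (δ-le G x)) (cutsAt≥deg*d C' x a b pa' pb'))

    tight-at-neighbour : ∀ y → Adj G x y ≡ true → cutH (trace C x) (trace C y) ≤ d
    tight-at-neighbour y ay with cutH (trace C x) (trace C y) NP.≤? d
    ... | yes h = h
    ... | no h = ⊥-elim (NP.<-irrefl refl (NP.<-≤-trans
          (NP.≤-<-trans deg*d-bound (sum-strict y (fibreCut≥d C x a b pa pb) (more (Adj G x y) ay (NP.≰⇒> h))))
          (cutsAt≤card C x sep)))
      where
      deg*d-bound : card S ≤ sumFin (λ y → if Adj G x y then d else 0)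
      deg*d-bound = subst (card S ≤_) (sym (sum-ind-mul (Adj G x) d))
                      (subst (_≤ count (Adj G x) * d) (sym card≡) (NP.*-monoˡ-≤ d (δ-le G x)))
      more : ∀ t → t ≡ true → d < cutH (trace C x) (trace C y) →
             (if t then d else 0) < (if t then cutH (trace C x) (trace C y) else 0)
      more true _ h = h

    -- a neighbour y of x with non-constant trace has no neighbour besides x,
    -- since a further cut of ≥ d ≥ 2 pairs would not fit into S
    only-neighbour : ∀ y z (c₁ e₁ : Fin (V H)) → Adj G x y ≡ true → C (y , c₁) ≡ true →
                     C (y , e₁) ≡ false → Adj G y z ≡ true → z ≡ x
    only-neighbour y z c₁ e₁ ay yc ye ayz with z FP.≟ x
    ... | yes e = e
    ... | no z≢x = ⊥-elim (no-room
          (NP.≤-trans (two-cutsAt+other≤crossing C x y z (adjacent-≢ x y ay) z≢x) (pairs-mono sep))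
          (card≤cutsAt C pa pb)
          (NP.≤-trans (2≤d a) (subst (λ t → d ≤ (if t then cutH (trace C y) (trace C z) else 0)) (sym ayz)
            (cut-lower-bound (trace C y) (trace C z) c₁ e₁ yc ye))))

    module NonconstantNeighbour (y : Fin (V G)) (c₁ e₁ : Fin (V H)) (ay : Adj G x y ≡ true)
              (yc : C (y , c₁) ≡ true) (ye : C (y , e₁) ≡ false) (connG : Connected G) (2≤|G| : 2 ≤ V G) where
      nbrs-of-y : ∀ z → Adj G y z ≡ true → z ≡ x
      nbrs-of-y z = only-neighbour y z c₁ e₁ ay yc ye

      δG≤1 : δ G ≤ 1
      δG≤1 = NP.≤-trans (δ-le G y) (count≤1 (Adj G y) x nbrs-of-y)

      -- deg(x)·d ≤ |S| = δ(G)·d ≤ d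
      deg-x≤1 : degree G x ≤ 1
      deg-x≤1 = factor≤1 (degree G x) d 1≤d
        (NP.≤-trans (cutsAt≥deg*d C x a b pa pb) (NP.≤-trans (cutsAt≤card C x sep)
          (subst (_≤ d) (sym card≡) (subst (δ G * d ≤_) (NP.*-identityˡ d) (NP.*-monoˡ-≤ d δG≤1)))))

      nbrs-of-x : ∀ z → Adj G x z ≡ true → z ≡ y
      nbrs-of-x z az with z FP.≟ y
      ... | yes e = e
      ... | no ne = ⊥-elim (NP.<-irrefl refl (NP.≤-trans (count-two (Adj G x) y z (λ e → ne (sym e)) ay az) deg-x≤1))

      -- {x, y} is closed under adjacency, hence everything by connectivity
      walk : ∀ {p q} → Reach (Adj G) p q → (p ≡ x ⊎ p ≡ y) → (q ≡ x ⊎ q ≡ y)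
      walk here h = h
      walk (step {b = p'} e r) (inj₁ refl) = walk r (inj₂ (nbrs-of-x p' e))
      walk (step {b = p'} e r) (inj₂ refl) = walk r (inj₁ (nbrs-of-y p' e))

      x-or-y : ∀ z → z ≡ x ⊎ z ≡ y
      x-or-y z = walk (connG x z) (inj₁ refl)

      |G|≡2 : V G ≡ 2
      |G|≡2 = NP.≤-antisym (subst (_≤ 2) (count-true {V G})
          (subst (count {V G} (λ _ → true) ≤_) (count-or2 x y (λ e → adjacent-≢ x y ay (sym e)))
            (count-mono (λ i _ → member i (x-or-y i))))) 2≤|G|
        where
        member : ∀ i → (i ≡ x ⊎ i ≡ y) → ((i == x) ∨ (i == y)) ≡ true
        member i (inj₁ refl) rewrite ==-refl x = refl
        member i (inj₂ refl) rewrite ==-refl y = ∨-trueʳ (y == x) refl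

      G-is-K₂ : IsK2 G
      G-is-K₂ = |G|≡2 , λ p q ne → adjacent p q ne (x-or-y p) (x-or-y q)
        where
        adjacent : ∀ p q → p ≢ q → (p ≡ x ⊎ p ≡ y) → (q ≡ x ⊎ q ≡ y) → Adj G p q ≡ true
        adjacent p q ne (inj₁ refl) (inj₁ refl) = ⊥-elim (ne refl)
        adjacent p q ne (inj₁ refl) (inj₂ refl) = ay
        adjacent p q ne (inj₂ refl) (inj₁ refl) = trans (Graph.sym G y x) ay
        adjacent p q ne (inj₂ refl) (inj₂ refl) = ⊥-elim (ne refl)

      H-join : JoinStructure H
      H-join = tight-cut-structure (trace C x) (trace C y) a b c₁ e₁ pa pb yc ye (tight-at-neighbour y ay)

    -- If every neighbouring trace is constant and one of them is empty, then
    -- C ∩ fibre(x) = {(x,a)} and S is exactly the star at (x,a).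
    module ConstantNeighbours
      (constant : ∀ y → Adj G x y ≡ true → (∀ w → C (y , w) ≡ false) ⊎ (∀ w → C (y , w) ≡ true))
      (y₀ : Fin (V G)) (ay₀ : Adj G x y₀ ≡ true) (empty₀ : ∀ w → C (y₀ , w) ≡ false) where

      |P|≤1 : count (trace C x) ≤ 1
      |P|≤1 = factor≤1 (count (trace C x)) d 1≤d
        (NP.≤-trans (cut-vs-empty (trace C x) (trace C y₀) empty₀) (tight-at-neighbour y₀ ay₀))

      -- a full neighbouring trace would also give |V∖P| ≤ 1, but |V(H)| ≥ 3
      neighbours-empty : ∀ y → Adj G x y ≡ true → ∀ w → C (y , w) ≡ false
      neighbours-empty y ay with constant y ay
      ... | inj₁ empty = empty
      ... | inj₂ full = ⊥-elim (NP.<-irrefl refl (NP.<-≤-trans 3≤n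
            (subst (_≤ 2) (count-compl (trace C x)) (NP.+-mono-≤ |P|≤1 |V∖P|≤1))))
        where
        3≤n : 3 ≤ V H
        3≤n = NP.<-≤-trans (s≤s (2≤d a)) (δ<n H a)
        |V∖P|≤1 : count (λ w → not (C (x , w))) ≤ 1
        |V∖P|≤1 = factor≤1 _ d 1≤d (NP.≤-trans (cut-vs-full (trace C x) (trace C y) full) (tight-at-neighbour y ay))

      w : Vtx
      w = (x , a)

      -- the singleton {w}: its crossing pairs are crossing pairs of C, so S separates it
      single : Vtx → Bool
      single p = p ==ᵖ w

      crossing-from-w : ∀ q → prodAdj G H w q ≡ true → crossing C w q ≡ true
      crossing-from-w (y , v) adj with ∧-true {Adj G x y} adj
      ... | ay , _ rewrite adj | pa | neighbours-empty y ay v = refl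

      crossing-to-w : ∀ p → prodAdj G H p w ≡ true → crossing C p w ≡ true
      crossing-to-w (z , u) adj with ∧-true {Adj G z x} adj
      ... | az , _ rewrite adj | pa | neighbours-empty z (trans (Graph.sym G x z) az) u = refl

      single-separated : Separates single
      single-separated p q t = sep p q (crossing-C p q t)
        where
        crossing-C : ∀ p q → crossing single p q ≡ true → crossing C p q ≡ true
        crossing-C p q t with p ==ᵖ w in e₁ | q ==ᵖ w in e₂
        ... | true | false with ==ᵖ→≡ p w e₁
        ...   | refl = crossing-from-w q (proj₁ (∧-true t))
        crossing-C p q t | false | true with ==ᵖ→≡ q w e₂
        ...   | refl = crossing-to-w p (proj₁ (∧-true t))
        crossing-C p q t | true  | true  = ⊥-elim (∧-false≢true (prodAdj G H p q) t)
        crossing-C p q t | false | false = ⊥-elim (∧-false≢true (prodAdj G H p q) t)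

      w≢ : ∀ q → prodAdj G H w q ≡ true → (q ==ᵖ w) ≡ false
      w≢ q adj with q ==ᵖ w in e
      ... | false = refl
      ... | true with trans (sym (prodAdj-loopless w)) (subst (λ t → prodAdj G H w t ≡ true) (==ᵖ→≡ q w e) adj)
      ...   | ()

      crossing-single : ∀ p q → (p ==ᵖ w) ≡ false → (q ==ᵖ w) ≡ false → crossing single p q ≡ false
      crossing-single p q e₁ e₂ rewrite e₁ | e₂ = ∧-zeroʳ (prodAdj G H p q)

      b≢a : b ≢ a
      b≢a refl with trans (sym pa) pb
      ... | ()

      card≤cutsAt-single : card S ≤ cutsAt single x
      card≤cutsAt-single = card≤cutsAt single (==ᵖ-refl w) single-b
        where
        single-b : single (x , b) ≡ false
        single-b rewrite ==-refl x = ≢→==f b a b≢a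

      -- an edge pq of S avoiding w would add two ordered pairs to the crossing
      -- pairs of {w}, which already use up all of S
      avoiding-w : ∀ p q → mem S p q ≡ true → (p ==ᵖ w) ≡ false → (q ==ᵖ w) ≡ false → ⊥
      avoiding-w p q pq∈S e₁ e₂ = no-room {e = 2}
          (NP.≤-trans (NP.+-monoˡ-≤ 2 (two-cutsAt≤crossing single x))
                      (NP.≤-trans (NP.≤-reflexive (NP.+-comm (pairs (crossing single)) 2)) two-more))
          card≤cutsAt-single NP.≤-refl
        where
        q≢p : (q ==ᵖ p) ≡ false
        q≢p with q ==ᵖ p in e
        ... | false = refl
        ... | true with trans (sym (prodAdj-loopless p))
                         (subst (λ t → prodAdj G H p t ≡ true) (==ᵖ→≡ q p e) (memSub S p q pq∈S))
        ...   | ()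
        plus-pq : Vtx → Vtx → Bool
        plus-pq r s = crossing single r s ∨ ((r ==ᵖ p) ∧ (s ==ᵖ q))
        plus-pq⊆S : ∀ r s → plus-pq r s ≡ true → mem S r s ≡ true
        plus-pq⊆S r s e with crossing single r s in et
        ... | true = single-separated r s et
        ... | false with ∧-true {r ==ᵖ p} e
        ...   | er , es rewrite ==ᵖ→≡ r p er | ==ᵖ→≡ s q es = pq∈S
        one-more : pairs (crossing single) < pairs plus-pq
        one-more = pairs-strict (λ r s e → subst (λ t → (t ∨ ((r ==ᵖ p) ∧ (s ==ᵖ q))) ≡ true) (sym e) refl) p q
          (∨-trueʳ (crossing single p q) (cong₂ _∧_ (==ᵖ-refl p) (==ᵖ-refl q)))
          (crossing-single p q e₁ e₂)
        two-more : suc (pairs (crossing single)) < pairs (mem S)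
        two-more = NP.<-≤-trans (s≤s one-more) (pairs-strict plus-pq⊆S q p (trans (memSym S q p) pq∈S)
          (subst (λ t → (t ∨ ((q ==ᵖ p) ∧ (p ==ᵖ q))) ≡ false) (sym (crossing-single q p e₂ e₁))
            (subst (λ t → (t ∧ (p ==ᵖ q)) ≡ false) (sym q≢p) refl)))

      single-from-w : ∀ q → prodAdj G H w q ≡ true → crossing single w q ≡ true
      single-from-w q adj rewrite ==ᵖ-refl w | w≢ q adj | adj = refl

      single-to-w : ∀ p → prodAdj G H p w ≡ true → crossing single p w ≡ true
      single-to-w p adj rewrite ==ᵖ-refl w | w≢ p (trans (prodAdj-sym w p) adj) | adj = refl

      star : IsStarAt G H S w
      star p q = incident , contained
        where
        contained : (prodAdj G H p q ≡ true × (p ≡ w ⊎ q ≡ w)) → mem S p q ≡ true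
        contained (adj , inj₁ refl) = single-separated w q (single-from-w q adj)
        contained (adj , inj₂ refl) = single-separated p w (single-to-w p adj)
        incident : mem S p q ≡ true → (prodAdj G H p q ≡ true × (p ≡ w ⊎ q ≡ w))
        incident pq∈S = memSub S p q pq∈S , at-w
          where
          at-w : p ≡ w ⊎ q ≡ w
          at-w with p ==ᵖ w in e₁
          ... | true = inj₁ (==ᵖ→≡ p w e₁)
          ... | false with q ==ᵖ w in e₂
          ...   | true  = inj₂ (==ᵖ→≡ q w e₂)
          ...   | false = ⊥-elim (avoiding-w p q pq∈S e₁ e₂)

  other-vertex : ∀ {k} (x : Fin k) → 2 ≤ k → Σ (Fin k) (λ x' → x' ≢ x)
  other-vertex {suc zero}    zero    (s≤s ())
  other-vertex {suc (suc k)} zero    _ = suc zero , λ ()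
  other-vertex {suc (suc k)} (suc x) _ = zero , λ ()

  some-neighbour : Connected G → 2 ≤ V G → ∀ x → Σ (Fin (V G)) (λ y → Adj G x y ≡ true)
  some-neighbour connG 2≤|G| x with other-vertex x 2≤|G|
  ... | x' , x'≢x with connG x x'
  ...   | here = ⊥-elim (x'≢x refl)
  ...   | step {b = y} e _ = y , e

  complement-separates : ∀ C → Separates C → Separates (λ p → not (C p))
  complement-separates C sep p q t =
    sep p q (trans (cong (prodAdj G H p q ∧_) (sym (xor-annihilates-not (C p) (C q)))) t)

  nonconstant-neighbour : (Vtx → Bool) → Fin (V G) → Fin (V G) → Bool
  nonconstant-neighbour C x y = Adj G x y ∧ (anyFin (trace C y) ∧ anyFin (λ w → not (C (y , w))))

  ConstantTraces : (Vtx → Bool) → Fin (V G) → Set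
  ConstantTraces C x = ∀ y → Adj G x y ≡ true → (∀ w → C (y , w) ≡ false) ⊎ (∀ w → C (y , w) ≡ true)

  constant-traces : ∀ C x → anyFin (nonconstant-neighbour C x) ≡ false → ConstantTraces C x
  constant-traces C x none y ay with ∧-false (anyFin-false _ none y)
  ... | inj₁ not-adj = ⊥-elim (false≢true (trans (sym not-adj) ay))
  ... | inj₂ const with ∧-false const
  ...   | inj₁ no-in  = inj₁ (anyFin-false _ no-in)
  ...   | inj₂ no-out = inj₂ (λ w → not-false (anyFin-false _ no-out w))

  constant-traces-complement : ∀ C x → ConstantTraces C x → ConstantTraces (λ p → not (C p)) x
  constant-traces-complement C x constant y ay with constant y ay
  ... | inj₁ empty = inj₂ (λ w → cong not (empty w))
  ... | inj₂ full  = inj₁ (λ w → cong not (full w))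

  equality-case : Connected G → 2 ≤ V G →
    ∀ C → Separates C → ∀ x a b → C (x , a) ≡ true → C (x , b) ≡ false → card S ≡ δ G * d →
    (∀ w → ¬ IsStarAt G H S w) → ¬ (IsK2 G × Σ ℕ (λ l → 1 ≤ l × IsoToJoin H l)) → ⊥
  equality-case connG 2≤|G| C sep x a b pa pb card≡ no-star not-exceptional
    with anyFin (nonconstant-neighbour C x) in found
  ... | true with anyFin-elim _ found
  ...   | y , e with ∧-true {Adj G x y} e
  ...     | ay , nonconstant with ∧-true {anyFin (trace C y)} nonconstant
  ...       | some-in , some-out with anyFin-elim _ some-in | anyFin-elim _ some-out
  ...         | c₁ , yc | e₁ , ye = not-exceptional (G-is-K₂ , join-structure-iso H H-join)
    where open EqualityCase.NonconstantNeighbour C sep x a b pa pb card≡ y c₁ e₁ ay yc (not-true ye) connG 2≤|G|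
  equality-case connG 2≤|G| C sep x a b pa pb card≡ no-star not-exceptional | false
    with some-neighbour connG 2≤|G| x
  ... | y₀ , ay₀ with constant-traces C x found y₀ ay₀
  ...   | inj₁ empty₀ = no-star (x , a)
          (EqualityCase.ConstantNeighbours.star C sep x a b pa pb card≡ (constant-traces C x found) y₀ ay₀ empty₀)
  ...   | inj₂ full₀  = no-star (x , b)
          (EqualityCase.ConstantNeighbours.star (λ p → not (C p)) (complement-separates C sep)
            x b a (cong not pb) (cong not pa) card≡
            (constant-traces-complement C x (constant-traces C x found)) y₀ ay₀ (λ w → cong not (full₀ w)))

  -- The fibres are connected unless some vertex set separated by S has a
  -- non-constant trace on a fibre: take C to be a component of G × H − S.
  fibres-connected : (∀ C x a b → Separates C → C (x , a) ≡ true → C (x , b) ≡ false → ⊥) →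
                     FibersConnected G H S
  fibres-connected no-separation x u v with Closure.component (V G) (V H) (removeAdj G H S) (x , u)
  ... | C , C-u , closed , reachable with C (x , v) in C-v
  ...   | true  = reachable (x , v) C-v
  ...   | false = ⊥-elim (no-separation C x u v (closed-separates C closed) C-u C-v)

lemma2 : (G H : Graph) → 2 ≤ V G → 2 ≤ V H → Connected G → Connected H →
         V H < 2 * δ H → (S : EdgeSet G H) →
         (card S < δ G * δ H → FibersConnected G H S)
         × (¬ (IsK2 G × Σ ℕ (λ l → 1 ≤ l × IsoToJoin H l)) →
            card S ≡ δ G * δ H →
            (∀ w → ¬ IsStarAt G H S w) →
            FibersConnected G H S)
lemma2 G H 2≤|G| _ connG _ n<2δ S = below , at-equality
  where
  n<2d : V H < δ H + δ H
  n<2d = subst (V H <_) (cong (δ H +_) (NP.+-identityʳ (δ H))) n<2δ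
  open DoubleCount G H S n<2d

  below : card S < δ G * δ H → FibersConnected G H S
  below |S|<δδ = fibres-connected (λ C x a b sep pa pb →
    NP.<⇒≱ |S|<δδ (separated-lower-bound C x a b sep pa pb))

  at-equality : ¬ (IsK2 G × Σ ℕ (λ l → 1 ≤ l × IsoToJoin H l)) → card S ≡ δ G * δ H →
                (∀ w → ¬ IsStarAt G H S w) → FibersConnected G H S
  at-equality not-exceptional |S|≡δδ no-star = fibres-connected (λ C x a b sep pa pb →
    equality-case connG 2≤|G| C sep x a b pa pb |S|≡δδ no-star not-exceptional)
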